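{- Let $f\in F(n)$ be a derangement, i.e. a permutation of $\{0,1\}^n$ with no fixed point. Then there exists $h\in F(n)$ with $h\sim f$ such that $\mathcal{A}(h)$ is strongly connected.
   Context: $F(n)$ is the set of all functions $f:\{0,1\}^n\to\{0,1\}^n$, written $f=(f_1,\dots,f_n)$. $e_i$ is the configuration with a $1$ exactly in component $i$; addition is componentwise modulo $2$. The asynchronous graph $\mathcal{A}(f)$ is the digraph on $\{0,1\}^n$ with an arc from $x$ to $x+e_i$ whenever $f_i(x)\neq x_i$. $\mathcal{S}(f)$ has an arc $x\to f(x)$ for every $x$; $f\sim h$ means $\mathcal{S}(f)$ and $\mathcal{S}(h)$ are isomorphic. -}

module Defs where

open import Data.Nat using (ℕ)
open import Data.Bool using (Bool; not)
open import Data.Fin using (Fin)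
open import Data.Vec using (Vec; lookup; updateAt)
open import Data.Product using (Σ; _×_)
open import Relation.Binary.PropositionalEquality using (_≡_; _≢_)
open import Relation.Binary.Construct.Closure.ReflexiveTransitive using (Star)
open import Function.Definitions using (Bijective)

Config : ℕ → Set
Config n = Vec Bool n

F : ℕ → Set
F n = Config n → Config n

flipAt : ∀ {n} → Config n → Fin n → Config n
flipAt x i = updateAt x i not

data AsyncArc {n : ℕ} (f : F n) : Config n → Config n → Set where
  arc : ∀ x (i : Fin n) → lookup (f x) i ≢ lookup x i → AsyncArc f x (flipAt x i)

StronglyConnected : ∀ {n} → F n → Set
StronglyConnected f = ∀ x y → Star (AsyncArc f) x y

Derangement : ∀ {n} → F n → Set
Derangement f = Bijective _≡_ _≡_ f × (∀ x → f x ≢ x)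

-- f ∼ h : the synchronous graphs S(f), S(h) (arcs x → f x) are isomorphic,
-- i.e. a bijection φ of {0,1}^n with  x → y in S(f)  iff  φ x → φ y in S(h)
_∼_ : ∀ {n} → F n → F n → Set
_∼_ {n} f h = Σ (Config n → Config n) λ φ →
  Bijective _≡_ _≡_ φ × (∀ x y → (f x ≡ y → h (φ x) ≡ φ y) × (h (φ x) ≡ φ y → f x ≡ y))

-- The cyclic Gray code gray 0, gray 1, …, gray (2^n - 1) is a Hamiltonian cycle of the hypercube.
-- If h sends every gray p to a configuration that differs from gray p in the coordinate flipped by
-- the step from gray p to gray (p + 1), then A(h) contains that cycle and is strongly connected.
-- Such an h conjugate to f is obtained by placing the cycles of f on the positions 0 … 2^n - 1 so
-- that every arc x → f x leads from a position p to a position across the p-th Gray step. Grouping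
-- positions into columns {2i, 2i+1}, an even position only asks for the right value of bit 0, and
-- from 2i + 1 one may go anywhere in the columns i + 1 and i + 2. Each cycle, of length at least 2
-- since f has no fixed point, is therefore laid out as a run of odd positions in consecutive
-- columns followed by a run of even positions, and these gadgets are chained from left to right,
-- odd cycles in pairs to get the parities right. For n ≤ 2 the few cases are placed by hand.

module Submission where

open import Defs
open import Data.Bool.Base using (Bool; true; false; not; _xor_; if_then_else_)
open import Data.Bool.Properties
  using (not-¬; not-injective; not-distribˡ-xor; xor-same; xor-identityʳ; xor-assoc)
  renaming (_≟_ to _≟ᵇ_)
open import Data.Empty using (⊥-elim)
open import Data.Fin.Base using (Fin; zero; suc; toℕ; fromℕ<; punchOut)
open import Data.Fin.Properties
  using (toℕ-injective; toℕ<n; fromℕ<-injective; any?; punchOut-injective; injective⇒≤; pigeonhole)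
  renaming (_≟_ to _≟ᶠ_)
open import Data.List.Base as List using (List; []; _∷_; _++_; map; length; applyUpTo; filter)
open import Data.List.Membership.Propositional using (_∈_)
open import Data.List.Membership.Propositional.Properties
  using (∈-lookup; ∈-++⁻; ∈-applyUpTo⁺; ∈-applyUpTo⁻; ∈-filter⁺; ∈-filter⁻)
open import Data.List.Properties using (length-++; length-applyUpTo)
open import Data.List.Relation.Binary.Permutation.Propositional using (_↭_; ↭-refl; ↭-sym; ↭-trans; prep; swap)
open import Data.List.Relation.Binary.Permutation.Propositional.Properties using (shift; ∈-resp-↭; map⁺)
open import Data.List.Relation.Unary.All as All using (All; []; _∷_)
open import Data.List.Relation.Unary.Any using (here; there)
open import Data.List.Relation.Unary.Unique.Propositional using (Unique; []; _∷_)
import Data.List.Relation.Unary.Unique.Propositional.Properties as Unique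
open import Data.Maybe.Base using (Maybe; nothing; just)
open import Data.Nat.Base
  using (ℕ; zero; suc; pred; _+_; _*_; _∸_; _^_; _≤_; _<_; z≤n; s≤s; s≤s⁻¹; ⌊_/2⌋; NonZero; _%_; _/_)
open import Data.Nat.DivMod
  using (m≡m%n+[m/n]*n; m%n<n; %-distribˡ-+; m<n⇒m%n≡m; m≤n⇒[n∸m]%m≡n%m; [m+kn]%n≡m%n)
open import Data.Nat.ListAction using (sum)
open import Data.Nat.ListAction.Properties using (sum-↭)
open import Data.Nat.Properties
open import Data.Nat.Tactic.RingSolver using (solve-∀)
open import Data.Product.Base using (Σ; ∃; ∃₂; _×_; _,_; proj₁; proj₂)
open import Data.Sum.Base using (_⊎_; inj₁; inj₂; [_,_]′)
open import Data.Vec.Base using ([]; _∷_; lookup)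
open import Data.Vec.Properties using (≡-dec; lookup∘updateAt; lookup∘updateAt′)
open import Function.Base using (_∘_)
open import Function.Definitions using (Bijective)
open import Relation.Binary.Construct.Closure.ReflexiveTransitive using (Star; ε; _◅_; _◅◅_)
open import Relation.Binary.Definitions using (DecidableEquality; tri<; tri≈; tri>)
open import Relation.Binary.PropositionalEquality
  using (_≡_; _≢_; refl; sym; trans; cong; cong₂; subst; subst₂; module ≡-Reasoning)
open import Relation.Nullary.Decidable.Core using (yes; no)
open import Relation.Nullary.Negation.Core using (¬_)
open import Relation.Unary using (Decidable)

-- Binary expansions and the Gray code

odd : ℕ → Bool
odd zero    = false
odd (suc k) = not (odd k)

odd-+ : ∀ m k → odd (m + k) ≡ odd m xor odd k
odd-+ zero    k = refl
odd-+ (suc m) k = trans (cong not (odd-+ m k)) (not-distribˡ-xor (odd m) (odd k))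

consBit : Bool → ℕ → ℕ
consBit false r = r + r
consBit true  r = suc (r + r)

odd-consBit : ∀ b r → odd (consBit b r) ≡ b
odd-consBit false r = trans (odd-+ r r) (xor-same (odd r))
odd-consBit true  r = cong not (odd-consBit false r)

⌊consBit/2⌋ : ∀ b r → ⌊ consBit b r /2⌋ ≡ r
⌊consBit/2⌋ false r       = sym (n≡⌊n+n/2⌋ r)
⌊consBit/2⌋ true  zero    = refl
⌊consBit/2⌋ true  (suc r) = cong suc (trans (cong ⌊_/2⌋ (+-suc r r)) (⌊consBit/2⌋ true r))

consBit-odd-⌊/2⌋ : ∀ k → consBit (odd k) ⌊ k /2⌋ ≡ k
consBit-odd-⌊/2⌋ zero          = refl
consBit-odd-⌊/2⌋ (suc zero)    = refl
consBit-odd-⌊/2⌋ (suc (suc k)) with odd k | consBit-odd-⌊/2⌋ k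
... | false | e = cong suc (trans (+-suc ⌊ k /2⌋ ⌊ k /2⌋) (cong suc e))
... | true  | e = cong (λ z → suc (suc z)) (trans (+-suc ⌊ k /2⌋ ⌊ k /2⌋) e)

consBit-injective : ∀ {b b′ r r′} → consBit b r ≡ consBit b′ r′ → b ≡ b′ × r ≡ r′
consBit-injective {b} {b′} {r} {r′} e =
    trans (sym (odd-consBit b r)) (trans (cong odd e) (odd-consBit b′ r′))
  , trans (sym (⌊consBit/2⌋ b r)) (trans (cong ⌊_/2⌋ e) (⌊consBit/2⌋ b′ r′))

odd-+-even : ∀ k e → odd e ≡ false → odd (k + e) ≡ odd k
odd-+-even k e e-even = trans (odd-+ k e) (trans (cong (odd k xor_) e-even) (xor-identityʳ (odd k)))

odd-+-double : ∀ k m → odd (k + (m + m)) ≡ odd k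
odd-+-double k m = odd-+-even k (m + m) (odd-consBit false m)

consBit-+-double : ∀ b r m → consBit b r + (m + m) ≡ consBit b (r + m)
consBit-+-double false r m = double-+ r m
  where double-+ : ∀ r m → r + r + (m + m) ≡ (r + m) + (r + m)
        double-+ = solve-∀
consBit-+-double true  r m = cong suc (consBit-+-double false r m)

+-double-decompose : ∀ k m → k + (m + m) ≡ consBit (odd k) (⌊ k /2⌋ + m)
+-double-decompose k m =
  trans (cong (_+ (m + m)) (sym (consBit-odd-⌊/2⌋ k))) (consBit-+-double (odd k) ⌊ k /2⌋ m)

⌊+double/2⌋ : ∀ k m → ⌊ k + (m + m) /2⌋ ≡ ⌊ k /2⌋ + m
⌊+double/2⌋ k m = trans (cong ⌊_/2⌋ (+-double-decompose k m)) (⌊consBit/2⌋ (odd k) _)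

xor-cancelʳ : ∀ a b → (a xor b) xor b ≡ a
xor-cancelʳ a b = trans (xor-assoc a b b) (trans (cong (a xor_) (xor-same b)) (xor-identityʳ a))

xor-injectiveʳ : ∀ a {x y} → a xor x ≡ a xor y → x ≡ y
xor-injectiveʳ false e = e
xor-injectiveʳ true  e = not-injective e

odd-+-≢ : ∀ k {x y} → odd x ≢ odd y → odd (k + x) ≢ odd (k + y)
odd-+-≢ k odd-x≢odd-y e = odd-x≢odd-y (xor-injectiveʳ (odd k) (trans (sym (odd-+ k _)) (trans e (odd-+ k _))))

odd-suc-≢ : ∀ k → odd (suc k) ≢ odd k
odd-suc-≢ k e = not-¬ refl (sym e)

even-+2 : ∀ b → odd b ≡ false → odd (b + 2) ≡ false
even-+2 b b-even = trans (odd-+-double b 1) b-even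

odd⇒pred-even : ∀ {b} → odd b ≡ true → b ≡ suc (pred b) × odd (pred b) ≡ false
odd⇒pred-even {suc b} b-odd = refl , not-injective b-odd

∸-suc-< : ∀ {d t} → t < d → d ∸ t ≡ suc (d ∸ suc t)
∸-suc-< {suc d} {zero}  _         = refl
∸-suc-< {suc d} {suc t} (s≤s t<d) = ∸-suc-< t<d

2^suc : ∀ n → 2 ^ suc n ≡ 2 ^ n + 2 ^ n
2^suc n = cong (2 ^ n +_) (+-identityʳ (2 ^ n))

-- The binary reflected Gray code, least significant bit first: bit i of gray n k is bit i xor
-- bit (i+1) of k, except that the top bit is bit (n-1) of k itself, which makes it 2^n-periodic.
gray : ∀ n → ℕ → Config n
gray zero          k = []
gray (suc zero)    k = odd k ∷ []
gray (suc (suc n)) k = (odd k xor odd ⌊ k /2⌋) ∷ gray (suc n) ⌊ k /2⌋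

grayDir : ∀ m → ℕ → Fin (suc m)
grayDir zero    k = zero
grayDir (suc m) k = if odd k then suc (grayDir m ⌊ k /2⌋) else zero

⌊suc/2⌋ : ∀ k → ⌊ suc k /2⌋ ≡ (if odd k then suc ⌊ k /2⌋ else ⌊ k /2⌋)
⌊suc/2⌋ zero = refl
⌊suc/2⌋ (suc zero) = refl
⌊suc/2⌋ (suc (suc k)) with odd k | ⌊suc/2⌋ k
... | true  | e = cong suc e
... | false | e = cong suc e

gray-suc : ∀ m k → gray (suc m) (suc k) ≡ flipAt (gray (suc m) k) (grayDir m k)
gray-suc zero    k = refl
gray-suc (suc m) k with odd k | ⌊suc/2⌋ k
... | false | e rewrite e = refl
... | true  | e rewrite e = cong (not (odd ⌊ k /2⌋) ∷_) (gray-suc m ⌊ k /2⌋)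

gray-periodic : ∀ n k → gray n (k + 2 ^ n) ≡ gray n k
gray-periodic zero          k = refl
gray-periodic (suc zero)    k = cong (_∷ []) (odd-+-double k 1)
gray-periodic (suc (suc n)) k = begin
  gray (suc (suc n)) (k + 2 ^ suc (suc n))
    ≡⟨ cong (gray (suc (suc n)) ∘ (k +_)) (2^suc (suc n)) ⟩
  gray (suc (suc n)) (k + (m + m))
    ≡⟨ cong₂ _∷_ (cong₂ _xor_ (odd-+-double k m) (cong odd (⌊+double/2⌋ k m)))
                 (cong (gray (suc n)) (⌊+double/2⌋ k m)) ⟩
  (odd k xor odd (h + m)) ∷ gray (suc n) (h + m)
    ≡⟨ cong₂ _∷_ (cong (odd k xor_) odd-h+m) (gray-periodic (suc n) h) ⟩
  gray (suc (suc n)) k ∎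
  where
  open ≡-Reasoning
  m h : ℕ
  m = 2 ^ suc n
  h = ⌊ k /2⌋
  odd-h+m : odd (h + m) ≡ odd h
  odd-h+m = trans (cong (odd ∘ (h +_)) (2^suc n)) (odd-+-double h (2 ^ n))

gray-+-multiple : ∀ n k t → gray n (k + t * 2 ^ n) ≡ gray n k
gray-+-multiple n k zero    = cong (gray n) (+-identityʳ k)
gray-+-multiple n k (suc t) = begin
  gray n (k + (2 ^ n + t * 2 ^ n)) ≡⟨ cong (gray n) (regroup k (2 ^ n) (t * 2 ^ n)) ⟩
  gray n ((k + t * 2 ^ n) + 2 ^ n) ≡⟨ gray-periodic n (k + t * 2 ^ n) ⟩
  gray n (k + t * 2 ^ n)           ≡⟨ gray-+-multiple n k t ⟩
  gray n k                         ∎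
  where
  open ≡-Reasoning
  regroup : ∀ a b c → a + (b + c) ≡ (a + c) + b
  regroup = solve-∀

rank : ∀ n → Config n → ℕ
rank zero          []      = 0
rank (suc zero)    (b ∷ []) = consBit b 0
rank (suc (suc n)) (b ∷ x) = consBit (b xor odd (rank (suc n) x)) (rank (suc n) x)

gray-rank : ∀ n x → gray n (rank n x) ≡ x
gray-rank zero          []       = refl
gray-rank (suc zero)    (b ∷ []) = cong (_∷ []) (odd-consBit b 0)
gray-rank (suc (suc n)) (b ∷ x)  =
  cong₂ _∷_ (trans (cong₂ _xor_ (odd-consBit c r) (cong odd (⌊consBit/2⌋ c r))) (xor-cancelʳ b (odd r)))
            (trans (cong (gray (suc n)) (⌊consBit/2⌋ c r)) (gray-rank (suc n) x))
  where
  r : ℕ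
  r = rank (suc n) x
  c : Bool
  c = b xor odd r

rank-injective : ∀ n {x y} → rank n x ≡ rank n y → x ≡ y
rank-injective n {x} {y} e = trans (sym (gray-rank n x)) (trans (cong (gray n) e) (gray-rank n y))

consBit-< : ∀ b {r m} → r < m → consBit b r < m + m
consBit-< false r<m = +-mono-≤ r<m (<⇒≤ r<m)
consBit-< true  {r} {m} r<m = subst (_≤ m + m) (cong suc (+-suc r r)) (+-mono-≤ r<m r<m)

rank<2^n : ∀ n x → rank n x < 2 ^ n
rank<2^n zero          []       = s≤s z≤n
rank<2^n (suc zero)    (b ∷ []) = consBit-< b {m = 1} (s≤s z≤n)
rank<2^n (suc (suc n)) (b ∷ x)  =
  subst (rank (suc (suc n)) (b ∷ x) <_) (sym (2^suc (suc n)))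
        (consBit-< (b xor odd (rank (suc n) x)) (rank<2^n (suc n) x))

⌊/2⌋-< : ∀ {k m} → k < m + m → ⌊ k /2⌋ < m
⌊/2⌋-< {k} {m} k<2m = subst (suc ⌊ k /2⌋ ≤_) (⌊consBit/2⌋ true m) (⌊n/2⌋-mono (s≤s k<2m))

rank-gray : ∀ n {k} → k < 2 ^ n → rank n (gray n k) ≡ k
rank-gray zero          {zero}        _ = refl
rank-gray zero          {suc k}       (s≤s ())
rank-gray (suc zero)    {zero}        _ = refl
rank-gray (suc zero)    {suc zero}    _ = refl
rank-gray (suc zero)    {suc (suc k)} (s≤s (s≤s ()))
rank-gray (suc (suc n)) {k}           k<2^n
  with rank (suc n) (gray (suc n) ⌊ k /2⌋)
     | rank-gray (suc n) (⌊/2⌋-< (subst (k <_) (2^suc (suc n)) k<2^n))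
... | _ | refl =
  trans (cong (λ b → consBit b ⌊ k /2⌋) (xor-cancelʳ (odd k) (odd ⌊ k /2⌋))) (consBit-odd-⌊/2⌋ k)

module _ (n : ℕ) where
  private instance
    2^n-nonZero : NonZero (2 ^ n)
    2^n-nonZero = m^n≢0 2 n

  gray-mod : ∀ k → gray n k ≡ gray n (k % 2 ^ n)
  gray-mod k =
    trans (cong (gray n) (m≡m%n+[m/n]*n k (2 ^ n))) (gray-+-multiple n (k % 2 ^ n) (k / 2 ^ n))

  rank-gray-mod : ∀ k → rank n (gray n k) ≡ k % 2 ^ n
  rank-gray-mod k = trans (cong (rank n) (gray-mod k)) (rank-gray n (m%n<n k (2 ^ n)))

  gray-≡⇒mod-≡ : ∀ {a b} → gray n a ≡ gray n b → a % 2 ^ n ≡ b % 2 ^ n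
  gray-≡⇒mod-≡ {a} {b} e = trans (sym (rank-gray-mod a)) (trans (cong (rank n) e) (rank-gray-mod b))

  gray-suc-cong : ∀ {a b} → gray n a ≡ gray n b → gray n (suc a) ≡ gray n (suc b)
  gray-suc-cong {a} {b} e = begin
    gray n (suc a)                           ≡⟨ gray-mod (1 + a) ⟩
    gray n ((1 + a) % 2 ^ n)                 ≡⟨ cong (gray n) (%-distribˡ-+ 1 a (2 ^ n)) ⟩
    gray n ((1 % 2 ^ n + a % 2 ^ n) % 2 ^ n)
      ≡⟨ cong (λ r → gray n ((1 % 2 ^ n + r) % 2 ^ n)) (gray-≡⇒mod-≡ e) ⟩
    gray n ((1 % 2 ^ n + b % 2 ^ n) % 2 ^ n) ≡⟨ cong (gray n) (sym (%-distribˡ-+ 1 b (2 ^ n))) ⟩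
    gray n ((1 + b) % 2 ^ n)                 ≡⟨ sym (gray-mod (1 + b)) ⟩
    gray n (suc b)                           ∎
    where open ≡-Reasoning

rankFin : ∀ n → Config n → Fin (2 ^ n)
rankFin n x = fromℕ< (rank<2^n n x)

rankFin-injective : ∀ n {x y} → rankFin n x ≡ rankFin n y → x ≡ y
rankFin-injective n {x} {y} e = rank-injective n (fromℕ<-injective _ _ (rank<2^n n x) (rank<2^n n y) e)

Fin-injective⇒surjective : ∀ {k} (g : Fin k → Fin k) → (∀ {a b} → g a ≡ g b → a ≡ b) →
                           ∀ y → ∃ λ x → g x ≡ y
Fin-injective⇒surjective {zero}  g _ ()
Fin-injective⇒surjective {suc k} g g-injective y with any? (λ x → g x ≟ᶠ y)
... | yes hit = hit
... | no miss = ⊥-elim (1+n≰n (injective⇒≤ {f = g′} g′-injective))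
  where
  y≢g : ∀ x → y ≢ g x
  y≢g x e = miss (x , sym e)
  g′ : Fin (suc k) → Fin k
  g′ x = punchOut (y≢g x)
  g′-injective : ∀ {a b} → g′ a ≡ g′ b → a ≡ b
  g′-injective {a} {b} e = g-injective (punchOut-injective (y≢g a) (y≢g b) e)

Config-injective⇒surjective : ∀ {n} (g : Config n → Config n) → (∀ {a b} → g a ≡ g b → a ≡ b) →
                             ∀ y → ∃ λ x → g x ≡ y
Config-injective⇒surjective {n} g g-injective y
  with Fin-injective⇒surjective (rankFin n ∘ g ∘ grayFin) G-injective (rankFin n y)
  where
  grayFin : Fin (2 ^ n) → Config n
  grayFin i = gray n (toℕ i)
  G-injective : ∀ {a b} → rankFin n (g (grayFin a)) ≡ rankFin n (g (grayFin b)) → a ≡ b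
  G-injective {a} {b} e = toℕ-injective (begin
    toℕ a                   ≡⟨ sym (rank-gray n (toℕ<n a)) ⟩
    rank n (grayFin a)      ≡⟨ cong (rank n) (g-injective (rankFin-injective n e)) ⟩
    rank n (grayFin b)      ≡⟨ rank-gray n (toℕ<n b) ⟩
    toℕ b                   ∎)
    where open ≡-Reasoning
... | i , e = gray n (toℕ i) , rankFin-injective n e

Unique-lookup-injective : ∀ {A : Set} {xs : List A} → Unique xs →
                          ∀ i j → List.lookup xs i ≡ List.lookup xs j → i ≡ j
Unique-lookup-injective (_ ∷ _)      zero    zero    _ = refl
Unique-lookup-injective (x∉ ∷ _)     zero    (suc j) e = ⊥-elim (All.lookup x∉ (∈-lookup j) e)
Unique-lookup-injective (x∉ ∷ _)     (suc i) zero    e = ⊥-elim (All.lookup x∉ (∈-lookup i) (sym e))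
Unique-lookup-injective (_ ∷ unique) (suc i) (suc j) e = cong suc (Unique-lookup-injective unique i j e)

Unique⇒length≤2^n : ∀ {n} {xs : List (Config n)} → Unique xs → length xs ≤ 2 ^ n
Unique⇒length≤2^n {n} {xs} unique =
  injective⇒≤ {f = rankFin n ∘ List.lookup xs}
              (λ e → Unique-lookup-injective unique _ _ (rankFin-injective n e))

enumeration : ∀ n → List (Config n)
enumeration n = applyUpTo (gray n) (2 ^ n)

enumeration-unique : ∀ n → Unique (enumeration n)
enumeration-unique n = Unique.applyUpTo⁺₁ (gray n) (2 ^ n) λ {i} {j} i<j j<2^n e →
  <-irrefl (trans (sym (rank-gray n (<-trans i<j j<2^n))) (trans (cong (rank n) e) (rank-gray n j<2^n))) i<j

∈-enumeration : ∀ {n} x → x ∈ enumeration n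
∈-enumeration {n} x = subst (_∈ enumeration n) (gray-rank n x) (∈-applyUpTo⁺ (gray n) (rank<2^n n x))

-- Strong connectivity along the Gray cycle

module _ {n} (h : F n) (gray-step : ∀ p → Star (AsyncArc h) (gray n p) (gray n (suc p))) where

  gray-walk : ∀ a k → Star (AsyncArc h) (gray n a) (gray n (k + a))
  gray-walk a zero    = ε
  gray-walk a (suc k) = gray-walk a k ◅◅ gray-step (k + a)

  strongly-connected-along-gray : StronglyConnected h
  strongly-connected-along-gray x y =
    subst₂ (Star (AsyncArc h)) (gray-rank n x) reach (gray-walk (rank n x) k)
    where
    k : ℕ
    k = rank n y + 2 ^ n ∸ rank n x
    reach : gray n (k + rank n x) ≡ y
    reach = begin
      gray n (k + rank n x)      ≡⟨ cong (gray n) (m∸n+n≡m rank-x≤) ⟩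
      gray n (rank n y + 2 ^ n)  ≡⟨ gray-periodic n (rank n y) ⟩
      gray n (rank n y)          ≡⟨ gray-rank n y ⟩
      y                          ∎
      where
      open ≡-Reasoning
      rank-x≤ : rank n x ≤ rank n y + 2 ^ n
      rank-x≤ = ≤-trans (<⇒≤ (rank<2^n n x)) (m≤n+m _ (rank n y))

-- If h maps gray p to gray q with Crosses m p q, then A(h) has the arc from gray p to gray (suc p).
Crosses : ∀ m → ℕ → ℕ → Set
Crosses m p q = lookup (gray (suc m) q) (grayDir m p) ≢ lookup (gray (suc m) p) (grayDir m p)

gray-arc : ∀ {m} (h : F (suc m)) k →
           lookup (h (gray (suc m) k)) (grayDir m k) ≢ lookup (gray (suc m) k) (grayDir m k) →
           AsyncArc h (gray (suc m) k) (gray (suc m) (suc k))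
gray-arc {m} h k ne = subst (AsyncArc h (gray (suc m) k)) (sym (gray-suc m k)) (arc (gray (suc m) k) (grayDir m k) ne)

crosses-suc : ∀ m k → Crosses m k (suc k)
crosses-suc m k e = not-¬ refl (sym (trans (sym flipped) e))
  where
  flipped : lookup (gray (suc m) (suc k)) (grayDir m k) ≡ not (lookup (gray (suc m) k) (grayDir m k))
  flipped = trans (cong (λ x → lookup x (grayDir m k)) (gray-suc m k))
                  (lookup∘updateAt (grayDir m k) (gray (suc m) k))

StronglyConnectedConjugate : ∀ {n} → F n → Set
StronglyConnectedConjugate {n} f = Σ (F n) λ h → (h ∼ f) × StronglyConnected h

-- Transporting f along x ↦ gray (pos x) turns each arc x → f x of S(f) into a Gray step of A(h).
module _ {m} (f : F (suc m)) (pos : Config (suc m) → ℕ)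
         (pos-injective : ∀ {x y} → gray (suc m) (pos x) ≡ gray (suc m) (pos y) → x ≡ y)
         (pos-crosses : ∀ x → Crosses m (pos x) (pos (f x))) where
  private
    n : ℕ
    n = suc m

    ψ : Config n → Config n
    ψ x = gray n (pos x)

    φ : Config n → Config n
    φ y = proj₁ (Config-injective⇒surjective ψ pos-injective y)

    ψ∘φ : ∀ y → ψ (φ y) ≡ y
    ψ∘φ y = proj₂ (Config-injective⇒surjective ψ pos-injective y)

    φ∘ψ : ∀ x → φ (ψ x) ≡ x
    φ∘ψ x = pos-injective (ψ∘φ (ψ x))

    h : F n
    h y = ψ (f (φ y))

    φ-bijective : Bijective _≡_ _≡_ φ
    φ-bijective = (λ {a} {b} e → trans (sym (ψ∘φ a)) (trans (cong ψ e) (ψ∘φ b)))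
                , λ x → ψ x , λ e → trans (cong φ e) (φ∘ψ x)

    h∼f : h ∼ f
    h∼f = φ , φ-bijective , λ y z → (λ e → trans (sym (φ∘ψ (f (φ y)))) (cong φ e))
                                  , (λ e → trans (cong ψ e) (ψ∘φ z))

    h-gray-step : ∀ p → Star (AsyncArc h) (gray n p) (gray n (suc p))
    h-gray-step p = subst₂ (Star (AsyncArc h)) ψx≡ (gray-suc-cong n ψx≡) (gray-arc h (pos x) h-crosses ◅ ε)
      where
      x : Config n
      x = φ (gray n p)
      ψx≡ : ψ x ≡ gray n p
      ψx≡ = ψ∘φ (gray n p)
      h-crosses : lookup (h (ψ x)) (grayDir m (pos x)) ≢ lookup (ψ x) (grayDir m (pos x))
      h-crosses = subst (λ z → lookup (ψ (f z)) (grayDir m (pos x)) ≢ lookup (ψ x) (grayDir m (pos x)))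
                        (sym (φ∘ψ x)) (pos-crosses x)

  conjugate-along-gray : StronglyConnectedConjugate f
  conjugate-along-gray = h , h∼f , strongly-connected-along-gray h h-gray-step

-- Orbits of an injective map

least : ∀ {P : ℕ → Set} → Decidable P → ∀ {m} → P m →
        ∃ λ k → k ≤ m × P k × (∀ {i} → i < k → ¬ P i)
least P? p with P? 0
... | yes p₀ = 0 , z≤n , p₀ , λ ()
least P? {zero}  p | no ¬p₀ = ⊥-elim (¬p₀ p)
least P? {suc m} p | no ¬p₀ with least (P? ∘ suc) p
... | k , k≤m , pk , below =
  suc k , s≤s k≤m , pk , λ { {zero} _ → ¬p₀ ; {suc i} i<k → below (s≤s⁻¹ i<k) }

argmin : (g : ℕ → ℕ) → ∀ L → ∃ λ j → j < suc L × (∀ {i} → i < suc L → g j ≤ g i)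
argmin g zero = 0 , s≤s z≤n , λ { (s≤s z≤n) → ≤-refl }
argmin g (suc L) with argmin g L
... | j , j<sL , j-min with g j ≤? g (suc L)
...   | yes gj≤ = j , m<n⇒m<1+n j<sL , λ i< → [ j-min , (λ { refl → gj≤ }) ]′ (m<1+n⇒m<n∨m≡n i<)
...   | no  gj≰ = suc L , ≤-refl , λ i< →
  [ (λ i<sL → ≤-trans (<⇒≤ (≰⇒> gj≰)) (j-min i<sL)) , (λ { refl → ≤-refl }) ]′ (m<1+n⇒m<n∨m≡n i<)

_≟ᶜ_ : ∀ {n} → DecidableEquality (Config n)
_≟ᶜ_ = ≡-dec _≟ᵇ_

module Orbits {n} (f : F n) (f-injective : ∀ {x y} → f x ≡ f y → x ≡ y) where

  iter : ℕ → Config n → Config n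
  iter zero    x = x
  iter (suc k) x = f (iter k x)

  iter-+ : ∀ a b x → iter (a + b) x ≡ iter a (iter b x)
  iter-+ zero    b x = refl
  iter-+ (suc a) b x = cong f (iter-+ a b x)

  iter-comm : ∀ a b x → iter a (iter b x) ≡ iter b (iter a x)
  iter-comm a b x = trans (sym (iter-+ a b x)) (trans (cong (λ k → iter k x) (+-comm a b)) (iter-+ b a x))

  iter-injective : ∀ a {x y} → iter a x ≡ iter a y → x ≡ y
  iter-injective zero    e = e
  iter-injective (suc a) e = iter-injective a (f-injective e)

  returns : ∀ x → ∃ λ k → k < 2 ^ n × iter (suc k) x ≡ x
  returns x with pigeonhole (n<1+n (2 ^ n)) (λ i → rankFin n (iter (toℕ i) x))
  ... | i , j , i<j , e = k , k<2^n , iter-injective (toℕ i) (begin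
    iter (toℕ i) (iter (suc k) x)  ≡⟨ iter-comm (toℕ i) (suc k) x ⟩
    iter (suc k) (iter (toℕ i) x)  ≡⟨ sym (iter-+ (suc k) (toℕ i) x) ⟩
    iter (suc k + toℕ i) x         ≡⟨ cong (λ l → iter l x) j≡ ⟩
    iter (toℕ j) x                 ≡⟨ sym (rankFin-injective n e) ⟩
    iter (toℕ i) x                 ∎)
    where
    open ≡-Reasoning
    k : ℕ
    k = toℕ j ∸ suc (toℕ i)
    j≡ : suc k + toℕ i ≡ toℕ j
    j≡ = trans (cong (_+ toℕ i) (sym (+-∸-assoc 1 i<j))) (m∸n+n≡m (<⇒≤ i<j))
    k<2^n : k < 2 ^ n
    k<2^n = ≤-trans (subst (suc k ≤_) j≡ (m≤m+n (suc k) (toℕ i))) (s≤s⁻¹ (toℕ<n j))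

  -- The searches are abstract: unfolding them during unification makes type checking intractable.
  abstract
    firstReturn : ∀ x → ∃ λ k → k ≤ proj₁ (returns x) × iter (suc k) x ≡ x ×
                                (∀ {i} → i < k → iter (suc i) x ≢ x)
    firstReturn x = least (λ k → iter (suc k) x ≟ᶜ x) (proj₂ (proj₂ (returns x)))

  period : Config n → ℕ
  period x = suc (proj₁ (firstReturn x))

  iter-period : ∀ x → iter (period x) x ≡ x
  iter-period x = proj₁ (proj₂ (proj₂ (firstReturn x)))

  period-minimal : ∀ x {i} → 0 < i → i < period x → iter i x ≢ x
  period-minimal x {suc i} _ i<p = proj₂ (proj₂ (proj₂ (firstReturn x))) (s≤s⁻¹ i<p)

  period≤2^n : ∀ x → period x ≤ 2 ^ n
  period≤2^n x = ≤-trans (s≤s (proj₁ (proj₂ (firstReturn x)))) (proj₁ (proj₂ (returns x)))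

  iter-+-period-multiple : ∀ x a t → iter (a + t * period x) x ≡ iter a x
  iter-+-period-multiple x a zero    = cong (λ k → iter k x) (+-identityʳ a)
  iter-+-period-multiple x a (suc t) = begin
    iter (a + (p + t * p)) x      ≡⟨ cong (λ k → iter k x) (+-comm-middle a p (t * p)) ⟩
    iter (p + (a + t * p)) x      ≡⟨ iter-+ p (a + t * p) x ⟩
    iter p (iter (a + t * p) x)   ≡⟨ cong (iter p) (iter-+-period-multiple x a t) ⟩
    iter p (iter a x)             ≡⟨ iter-comm p a x ⟩
    iter a (iter p x)             ≡⟨ cong (iter a) (iter-period x) ⟩
    iter a x                      ∎
    where
    open ≡-Reasoning
    p : ℕ
    p = period x
    +-comm-middle : ∀ a b c → a + (b + c) ≡ b + (a + c)
    +-comm-middle = solve-∀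

  iter-mod-period : ∀ x a → iter a x ≡ iter (a % period x) x
  iter-mod-period x a =
    trans (cong (λ k → iter k x) (m≡m%n+[m/n]*n a (period x)))
          (iter-+-period-multiple x (a % period x) (a / period x))

  iter-undo : ∀ i x → iter (pred (period x) * i) (iter i x) ≡ x
  iter-undo i x = begin
    iter (pred (period x) * i) (iter i x)  ≡⟨ sym (iter-+ (pred (period x) * i) i x) ⟩
    iter (pred (period x) * i + i) x       ≡⟨ cong (λ k → iter k x) (trans (+-comm _ i) (*-comm (period x) i)) ⟩
    iter (0 + i * period x) x              ≡⟨ iter-+-period-multiple x 0 i ⟩
    x                                      ∎
    where open ≡-Reasoning

  iter-distinct : ∀ x {a b} → a < b → b < period x → iter a x ≢ iter b x
  iter-distinct x {a} {b} a<b b<p e =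
    period-minimal x (m<n⇒0<n∸m a<b) (≤-<-trans (m∸n≤m b a) b<p) (iter-injective a (begin
      iter a (iter (b ∸ a) x)  ≡⟨ iter-comm a (b ∸ a) x ⟩
      iter (b ∸ a) (iter a x)  ≡⟨ sym (iter-+ (b ∸ a) a x) ⟩
      iter (b ∸ a + a) x       ≡⟨ cong (λ k → iter k x) (m∸n+n≡m (<⇒≤ a<b)) ⟩
      iter b x                 ≡⟨ sym e ⟩
      iter a x                 ∎))
    where open ≡-Reasoning

  iter-index-unique : ∀ x {a b} → a < period x → b < period x → iter a x ≡ iter b x → a ≡ b
  iter-index-unique x {a} {b} a<p b<p e with <-cmp a b
  ... | tri< a<b _ _ = ⊥-elim (iter-distinct x a<b b<p e)
  ... | tri≈ _ a≡b _ = a≡b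
  ... | tri> _ _ b<a = ⊥-elim (iter-distinct x b<a a<p (sym e))

  abstract
    minimiser : ∀ x → ∃ λ j → j < period x ×
                              (∀ {i} → i < period x → rank n (iter j x) ≤ rank n (iter i x))
    minimiser x = argmin (λ j → rank n (iter j x)) (pred (period x))

  rep : Config n → Config n
  rep x = iter (proj₁ (minimiser x)) x

  rep-minimal : ∀ x i → rank n (rep x) ≤ rank n (iter i x)
  rep-minimal x i = subst (λ y → rank n (rep x) ≤ rank n y) (sym (iter-mod-period x i))
                          (proj₂ (proj₂ (minimiser x)) (m%n<n i (period x)))

  rep-iter : ∀ i x → rep (iter i x) ≡ rep x
  rep-iter i x = rank-injective n (≤-antisym
    (subst (λ y → rank n (rep (iter i x)) ≤ rank n y) back (rep-minimal (iter i x) (j + pred (period x) * i)))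
    (subst (λ y → rank n (rep x) ≤ rank n y) (iter-+ j′ i x) (rep-minimal x (j′ + i))))
    where
    j j′ : ℕ
    j  = proj₁ (minimiser x)
    j′ = proj₁ (minimiser (iter i x))
    back : iter (j + pred (period x) * i) (iter i x) ≡ rep x
    back = trans (iter-+ j _ (iter i x)) (cong (iter j) (iter-undo i x))

  rep-f : ∀ x → rep (f x) ≡ rep x
  rep-f = rep-iter 1

  IsRep : Config n → Set
  IsRep r = rep r ≡ r

  rep-isRep : ∀ x → IsRep (rep x)
  rep-isRep x = rep-iter (proj₁ (minimiser x)) x

  abstract
    index : Config n → ℕ
    index x = (pred (period x) * proj₁ (minimiser x)) % period (rep x)

    index<period : ∀ x → index x < period (rep x)
    index<period x = m%n<n (pred (period x) * proj₁ (minimiser x)) (period (rep x))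

    iter-index : ∀ x → iter (index x) (rep x) ≡ x
    iter-index x = trans (sym (iter-mod-period (rep x) (pred (period x) * proj₁ (minimiser x))))
                         (iter-undo (proj₁ (minimiser x)) x)

  index-f<period : ∀ x → index (f x) < period (rep x)
  index-f<period x = subst (λ r → index (f x) < period r) (rep-f x) (index<period (f x))

  iter-index-f : ∀ x → iter (index (f x)) (rep x) ≡ iter (suc (index x)) (rep x)
  iter-index-f x = trans (subst (λ r → iter (index (f x)) r ≡ f x) (rep-f x) (iter-index (f x)))
                         (sym (cong f (iter-index x)))

  index-f : ∀ x → (suc (index x) < period (rep x) × index (f x) ≡ suc (index x))
                ⊎ (suc (index x) ≡ period (rep x) × index (f x) ≡ 0)
  index-f x with m≤n⇒m<n∨m≡n (index<period x)
  ... | inj₁ lt = inj₁ (lt , iter-index-unique (rep x) (index-f<period x) lt (iter-index-f x))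
  ... | inj₂ eq = inj₂ (eq , iter-index-unique (rep x) (index-f<period x) (s≤s z≤n)
    (trans (iter-index-f x) (trans (cong (λ k → iter k (rep x)) eq) (iter-period (rep x)))))

  module _ {A : Set} (R : A → A → Set) (lay : Config n → ℕ → A)
           (lay-step  : ∀ r {j} → IsRep r → suc j < period r → R (lay r j) (lay r (suc j)))
           (lay-close : ∀ r {j} → IsRep r → suc j ≡ period r → R (lay r j) (lay r 0)) where

    layout-respects-f : ∀ x → R (lay (rep x) (index x)) (lay (rep (f x)) (index (f x)))
    layout-respects-f x rewrite rep-f x with index-f x
    ... | inj₁ (lt , e) rewrite e = lay-step (rep x) (rep-isRep x) lt
    ... | inj₂ (eq , e) rewrite e = lay-close (rep x) (rep-isRep x) eq

  layout-injective : ∀ {A : Set} (lay : Config n → ℕ → A) →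
    (∀ {r r′ j j′} → IsRep r → IsRep r′ → j < period r → j′ < period r′ →
                     lay r j ≡ lay r′ j′ → r ≡ r′ × j ≡ j′) →
    ∀ {x y} → lay (rep x) (index x) ≡ lay (rep y) (index y) → x ≡ y
  layout-injective lay lay-injective {x} {y} e
    with lay-injective (rep-isRep x) (rep-isRep y) (index<period x) (index<period y) e
  ... | r≡ , j≡ = trans (sym (iter-index x)) (trans (cong₂ iter j≡ r≡) (iter-index y))

  orbit : Config n → List (Config n)
  orbit r = applyUpTo (λ j → iter j r) (period r)

  rep-∈-orbit : ∀ {r y} → IsRep r → y ∈ orbit r → rep y ≡ r
  rep-∈-orbit {r} r-rep y∈ with ∈-applyUpTo⁻ (λ j → iter j r) y∈
  ... | j , _ , refl = trans (rep-iter j r) r-rep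

  orbits : List (Config n) → List (Config n)
  orbits []       = []
  orbits (r ∷ rs) = orbit r ++ orbits rs

  length-orbits : ∀ rs → length (orbits rs) ≡ sum (map period rs)
  length-orbits []       = refl
  length-orbits (r ∷ rs) =
    trans (length-++ (orbit r)) (cong₂ _+_ (length-applyUpTo (λ j → iter j r) (period r)) (length-orbits rs))

  rep-∈-orbits : ∀ {rs y} → All IsRep rs → y ∈ orbits rs → rep y ∈ rs
  rep-∈-orbits {r ∷ rs} (r-rep ∷ rs-rep) y∈ with ∈-++⁻ (orbit r) y∈
  ... | inj₁ y∈r  = here (rep-∈-orbit r-rep y∈r)
  ... | inj₂ y∈rs = there (rep-∈-orbits rs-rep y∈rs)

  orbits-unique : ∀ {rs} → Unique rs → All IsRep rs → Unique (orbits rs)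
  orbits-unique {[]}     _              _              = []
  orbits-unique {r ∷ rs} (r∉ ∷ unique) (r-rep ∷ rs-rep) =
    Unique.++⁺ (Unique.applyUpTo⁺₁ (λ j → iter j r) (period r) (iter-distinct r))
               (orbits-unique unique rs-rep)
               λ (y∈r , y∈rs) →
                 All.lookup r∉ (subst (_∈ rs) (rep-∈-orbit r-rep y∈r) (rep-∈-orbits rs-rep y∈rs)) refl

  sum-periods≤2^n : ∀ {rs} → Unique rs → All IsRep rs → sum (map period rs) ≤ 2 ^ n
  sum-periods≤2^n {rs} unique rs-rep =
    subst (_≤ 2 ^ n) (length-orbits rs) (Unique⇒length≤2^n (orbits-unique unique rs-rep))

  reps : List (Config n)
  reps = filter (λ x → rep x ≟ᶜ x) (enumeration n)

  reps-unique : Unique reps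
  reps-unique = Unique.filter⁺ (λ x → rep x ≟ᶜ x) (enumeration-unique n)

  reps-isRep : All IsRep reps
  reps-isRep = All.tabulate λ r∈ → proj₂ (∈-filter⁻ (λ x → rep x ≟ᶜ x) {xs = enumeration n} r∈)

  ∈-reps : ∀ {r} → IsRep r → r ∈ reps
  ∈-reps {r} r-rep = ∈-filter⁺ (λ x → rep x ≟ᶜ x) (∈-enumeration r) r-rep

  2≤period : (∀ x → f x ≢ x) → ∀ x → 2 ≤ period x
  2≤period no-fixed-point x =
    ≤∧≢⇒< (s≤s z≤n) (λ 1≡p → no-fixed-point x (subst (λ k → iter k x ≡ x) (sym 1≡p) (iter-period x)))

  period-+-period≤2^n : ∀ {r r′} → IsRep r → IsRep r′ → r ≢ r′ → period r + period r′ ≤ 2 ^ n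
  period-+-period≤2^n {r} {r′} r-rep r′-rep r≢r′ =
    subst (_≤ 2 ^ n) (cong (period r +_) (+-identityʳ (period r′)))
          (sum-periods≤2^n ((r≢r′ ∷ []) ∷ [] ∷ []) (r-rep ∷ r′-rep ∷ []))

module _ {m} (f : F (suc m)) (f-injective : ∀ {x y} → f x ≡ f y → x ≡ y) where
  open Orbits f f-injective

  record GrayCycleLayout : Set where
    field
      position           : Config (suc m) → ℕ → ℕ
      position-step      : ∀ r {j} → IsRep r → suc j < period r → Crosses m (position r j) (position r (suc j))
      position-close     : ∀ r {j} → IsRep r → suc j ≡ period r → Crosses m (position r j) (position r 0)
      position-injective : ∀ {r r′ j j′} → IsRep r → IsRep r′ → j < period r → j′ < period r′ →
                           gray (suc m) (position r j) ≡ gray (suc m) (position r′ j′) → r ≡ r′ × j ≡ j′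

  conjugate-from-layout : GrayCycleLayout → StronglyConnectedConjugate f
  conjugate-from-layout layout =
    conjugate-along-gray f (λ x → position (rep x) (index x))
      (layout-injective (λ r j → gray (suc m) (position r j)) position-injective)
      (layout-respects-f (Crosses m) position position-step position-close)
    where open GrayCycleLayout layout

  single-cycle-layout : ∀ r₀ → (∀ {r} → IsRep r → r ≡ r₀) → Crosses m (pred (period r₀)) 0 →
                        GrayCycleLayout
  single-cycle-layout r₀ only-r₀ closing = record
    { position           = λ _ j → j
    ; position-step      = λ _ {j} _ _ → crosses-suc m j
    ; position-close     = λ r {j} r-rep j+1≡p →
        subst (λ k → Crosses m k 0) (cong pred (trans (sym (cong period (only-r₀ r-rep))) (sym j+1≡p))) closing
    ; position-injective = λ {r} {r′} {j} {j′} r-rep r′-rep j<p j′<p e →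
        trans (only-r₀ r-rep) (sym (only-r₀ r′-rep)) ,
        trans (sym (rank-gray (suc m) (<-≤-trans j<p (period≤2^n r))))
              (trans (cong (rank (suc m)) e) (rank-gray (suc m) (<-≤-trans j′<p (period≤2^n r′))))
    }

-- Dimensions 1 and 2

module Dimension1 (f : F 1) (f-injective : ∀ {x y} → f x ≡ f y → x ≡ y)
                  (no-fixed-point : ∀ x → f x ≢ x) where
  open Orbits f f-injective

  r₀ : Config 1
  r₀ = rep (gray 1 0)

  only-r₀ : ∀ {r} → IsRep r → r ≡ r₀
  only-r₀ {r} r-rep with r ≟ᶜ r₀
  ... | yes r≡r₀ = r≡r₀
  ... | no  r≢r₀ = ⊥-elim (≤⇒≯ 4≤2 (s≤s (s≤s (s≤s z≤n))))
    where
    4≤2 : 2 + 2 ≤ 2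
    4≤2 = ≤-trans (+-mono-≤ (2≤period no-fixed-point r) (2≤period no-fixed-point r₀))
                  (period-+-period≤2^n r-rep (rep-isRep (gray 1 0)) r≢r₀)

  layout : GrayCycleLayout f f-injective
  layout = single-cycle-layout f f-injective r₀ only-r₀
    (subst (λ p → Crosses 0 (pred p) 0) (≤-antisym (2≤period no-fixed-point r₀) (period≤2^n r₀)) (λ ()))

module Dimension2 (f : F 2) (f-injective : ∀ {x y} → f x ≡ f y → x ≡ y)
                  (no-fixed-point : ∀ x → f x ≢ x) where
  open Orbits f f-injective

  r₀ : Config 2
  r₀ = rep (gray 2 0)

  r₀-rep : IsRep r₀
  r₀-rep = rep-isRep (gray 2 0)

  other-rep-periods : ∀ {r} → IsRep r → r ≢ r₀ → period r ≡ 2 × period r₀ ≡ 2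
  other-rep-periods {r} r-rep r≢r₀ = both-2 (2≤period no-fixed-point r) (2≤period no-fixed-point r₀)
                                             (period-+-period≤2^n r-rep r₀-rep r≢r₀)
    where
    both-2 : ∀ {a b} → 2 ≤ a → 2 ≤ b → a + b ≤ 4 → a ≡ 2 × b ≡ 2
    both-2 {a} {b} 2≤a 2≤b a+b≤4 =
        ≤-antisym (+-cancelʳ-≤ 2 a 2 (≤-trans (+-monoʳ-≤ a 2≤b) a+b≤4)) 2≤a
      , ≤-antisym (+-cancelˡ-≤ 2 b 2 (≤-trans (+-monoˡ-≤ b 2≤a) a+b≤4)) 2≤b

  other-reps-equal : ∀ {r r′} → IsRep r → IsRep r′ → r ≢ r₀ → r′ ≢ r₀ → r ≡ r′
  other-reps-equal {r} {r′} r-rep r′-rep r≢r₀ r′≢r₀ with r ≟ᶜ r′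
  ... | yes r≡r′ = r≡r′
  ... | no  r≢r′ = ⊥-elim (≤⇒≯ 6≤4 (s≤s (s≤s (s≤s (s≤s (s≤s z≤n))))))
    where
    unique : Unique (r ∷ r′ ∷ r₀ ∷ [])
    unique = (r≢r′ ∷ r≢r₀ ∷ []) ∷ (r′≢r₀ ∷ []) ∷ [] ∷ []
    6≤4 : 2 + (2 + (2 + 0)) ≤ 4
    6≤4 = ≤-trans (+-mono-≤ (2≤period no-fixed-point r) (+-mono-≤ (2≤period no-fixed-point r′)
                    (+-mono-≤ (2≤period no-fixed-point r₀) z≤n)))
                  (sum-periods≤2^n unique (r-rep ∷ r′-rep ∷ r₀-rep ∷ []))

  -- Two 2-cycles: the one through r₀ on positions 0, 2 and the other on positions 1, 3.
  module TwoCycles (p₀≡2 : period r₀ ≡ 2) where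

    period≡2 : ∀ {r} → IsRep r → period r ≡ 2
    period≡2 {r} r-rep with r ≟ᶜ r₀
    ... | yes refl = p₀≡2
    ... | no  r≢r₀ = proj₁ (other-rep-periods r-rep r≢r₀)

    side : Config 2 → Bool
    side r with r ≟ᶜ r₀
    ... | yes _ = false
    ... | no  _ = true

    side-injective : ∀ {r r′} → IsRep r → IsRep r′ → side r ≡ side r′ → r ≡ r′
    side-injective {r} {r′} r-rep r′-rep e with r ≟ᶜ r₀ | r′ ≟ᶜ r₀
    ... | yes r≡r₀ | yes r′≡r₀ = trans r≡r₀ (sym r′≡r₀)
    ... | no  r≢r₀ | no  r′≢r₀ = other-reps-equal r-rep r′-rep r≢r₀ r′≢r₀
    ... | yes _    | no  _     with () ← e
    ... | no  _    | yes _     with () ← e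

    position : Config 2 → ℕ → ℕ
    position r j = consBit (side r) j

    step : ∀ b {j} → suc j < 2 → Crosses 1 (consBit b j) (consBit b (suc j))
    step false {zero}  _ = λ ()
    step true  {zero}  _ = λ ()
    step _     {suc j} (s≤s (s≤s ()))

    close : ∀ b {j} → suc j ≡ 2 → Crosses 1 (consBit b j) (consBit b 0)
    close false {1} _ = λ ()
    close true  {1} _ = λ ()
    close _ {zero}        ()
    close _ {suc (suc j)} ()

    layout : GrayCycleLayout f f-injective
    layout = record
      { position           = position
      ; position-step      = λ r {j} r-rep j+1<p → step (side r) (subst (suc j <_) (period≡2 r-rep) j+1<p)
      ; position-close     = λ r r-rep j+1≡p → close (side r) (trans j+1≡p (period≡2 r-rep))
      ; position-injective = λ {r} {r′} {j} {j′} r-rep r′-rep j<p j′<p e →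
          let same = consBit-injective (trans (sym (rank-gray 2 (position<4 r-rep j<p)))
                                       (trans (cong (rank 2) e) (rank-gray 2 (position<4 r′-rep j′<p))))
          in side-injective r-rep r′-rep (proj₁ same) , proj₂ same
      }
      where
      position<4 : ∀ {r j} → IsRep r → j < period r → position r j < 4
      position<4 {r} {j} r-rep j<p = consBit-< (side r) {m = 2} (subst (j <_) (period≡2 r-rep) j<p)

  closing-3-or-4 : ∀ p → 2 ≤ p → p ≤ 4 → p ≢ 2 → Crosses 1 (pred p) 0
  closing-3-or-4 2 _ _ p≢2 = ⊥-elim (p≢2 refl)
  closing-3-or-4 1 (s≤s ()) _ _
  closing-3-or-4 3 _ _ _   = λ ()
  closing-3-or-4 4 _ _ _   = λ ()
  closing-3-or-4 (suc (suc (suc (suc (suc _))))) _ (s≤s (s≤s (s≤s (s≤s ())))) _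

  layout : GrayCycleLayout f f-injective
  layout with period r₀ ≟ 2
  ... | yes p₀≡2 = TwoCycles.layout p₀≡2
  ... | no  p₀≢2 = single-cycle-layout f f-injective r₀ only-r₀
                     (closing-3-or-4 (period r₀) (2≤period no-fixed-point r₀) (period≤2^n r₀) p₀≢2)
    where
    only-r₀ : ∀ {r} → IsRep r → r ≡ r₀
    only-r₀ {r} r-rep with r ≟ᶜ r₀
    ... | yes r≡r₀ = r≡r₀
    ... | no  r≢r₀ = ⊥-elim (p₀≢2 (proj₂ (other-rep-periods r-rep r≢r₀)))

-- Slots and gadgets

grayDir-consBit-false : ∀ m i → grayDir (suc m) (consBit false i) ≡ zero
grayDir-consBit-false m i rewrite odd-consBit false i = refl

grayDir-consBit-true : ∀ m i → grayDir (suc m) (consBit true i) ≡ suc (grayDir m i)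
grayDir-consBit-true m i rewrite odd-consBit true i | ⌊consBit/2⌋ true i = refl

gray-head : ∀ m b j → lookup (gray (suc (suc m)) (consBit b j)) zero ≡ b xor odd j
gray-head m b j = cong₂ _xor_ (odd-consBit b j) (cong odd (⌊consBit/2⌋ b j))

grayDir-suc-≢ : ∀ m i → grayDir (suc m) i ≢ grayDir (suc m) (suc i)
grayDir-suc-≢ m i with odd i
... | true  = λ ()
... | false = λ ()

crosses-suc-suc : ∀ m i → Crosses (suc m) i (suc (suc i))
crosses-suc-suc m i = crosses-suc (suc m) i ∘ trans (sym unchanged)
  where
  d : Fin (suc (suc m))
  d = grayDir (suc m) i
  unchanged : lookup (gray (suc (suc m)) (suc (suc i))) d ≡ lookup (gray (suc (suc m)) (suc i)) d
  unchanged = trans (cong (λ x → lookup x d) (gray-suc (suc m) (suc i)))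
                    (lookup∘updateAt′ d (grayDir (suc m) (suc i)) (grayDir-suc-≢ m i) (gray (suc (suc m)) (suc i)))

-- The positions 2i and 2i+1 form column i.
Slot : Set
Slot = ℕ × Bool

slotPosition : Slot → ℕ
slotPosition (i , b) = consBit b i

-- From the even position of column i the Gray step flips bit 0, which at consBit b j is b xor odd j.
-- From the odd position it flips, among the remaining bits, the bit flipped by the step from i to
-- i + 1, and both columns i + 1 and i + 2 are across that step.
SlotStep : Slot → Slot → Set
SlotStep (i , false) (j , b) = b xor odd j ≢ odd i
SlotStep (i , true)  (j , _) = j ≡ suc i ⊎ j ≡ suc (suc i)

slotStep-crosses : ∀ m {s t} → SlotStep s t → Crosses (suc (suc m)) (slotPosition s) (slotPosition t)
slotStep-crosses m {i , false} {j , b} step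
  rewrite grayDir-consBit-false (suc m) i | gray-head m b j | gray-head m false i = step
slotStep-crosses m {i , true} {j , b} step
  rewrite grayDir-consBit-true (suc m) i | ⌊consBit/2⌋ b j | ⌊consBit/2⌋ true i with step
... | inj₁ refl = crosses-suc (suc m) i
... | inj₂ refl = crosses-suc-suc m i

evenOffset : ℕ → ℕ → ℕ
evenOffset d t with t ≤? d
... | yes _ = d ∸ t
... | no  _ = t

evenOffset-down : ∀ {d t} → t ≤ d → evenOffset d t ≡ d ∸ t
evenOffset-down {d} {t} t≤d with t ≤? d
... | yes _   = refl
... | no  t≰d = ⊥-elim (t≰d t≤d)

evenOffset-up : ∀ {d t} → d < t → evenOffset d t ≡ t
evenOffset-up {d} {t} d<t with t ≤? d
... | yes t≤d = ⊥-elim (<⇒≱ d<t t≤d)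
... | no  _   = refl

evenOffset-step : ∀ d t → (t ≡ d → odd d ≡ false) → odd (evenOffset d (suc t)) ≢ odd (evenOffset d t)
evenOffset-step d t at-turn with <-cmp t d
... | tri< t<d _ _ rewrite evenOffset-down t<d | evenOffset-down (<⇒≤ t<d) | ∸-suc-< t<d =
  odd-suc-≢ (d ∸ suc t) ∘ sym
... | tri≈ _ refl _ rewrite evenOffset-up (n<1+n t) | evenOffset-down (≤-refl {t}) | n∸n≡0 t | at-turn refl = λ ()
... | tri> _ _ d<t rewrite evenOffset-up (m<n⇒m<1+n d<t) | evenOffset-up d<t = odd-suc-≢ t

evenOffset-injective : ∀ d {t t′} → evenOffset d t ≡ evenOffset d t′ → t ≡ t′
evenOffset-injective d {t} {t′} e with ≤-<-connex t d | ≤-<-connex t′ d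
... | inj₁ t≤d | inj₁ t′≤d = ∸-cancelˡ-≡ t≤d t′≤d (trans (sym (evenOffset-down t≤d)) (trans e (evenOffset-down t′≤d)))
... | inj₂ d<t | inj₂ d<t′ = trans (sym (evenOffset-up d<t)) (trans e (evenOffset-up d<t′))
... | inj₁ t≤d | inj₂ d<t′ = ⊥-elim (<⇒≢ (≤-<-trans (m∸n≤m d t) d<t′)
                                        (trans (sym (evenOffset-down t≤d)) (trans e (evenOffset-up d<t′))))
... | inj₂ d<t | inj₁ t′≤d = ⊥-elim (<⇒≢ (≤-<-trans (m∸n≤m d t′) d<t)
                                        (trans (sym (evenOffset-down t′≤d)) (trans (sym e) (evenOffset-up d<t))))

evenOffset-≤ : ∀ d u {t} → t ≤ d + u → evenOffset d t ≤ d + u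
evenOffset-≤ d u {t} t≤ with ≤-<-connex t d
... | inj₁ t≤d = subst (_≤ d + u) (sym (evenOffset-down t≤d)) (≤-trans (m∸n≤m d t) (m≤m+n d u))
... | inj₂ d<t = subst (_≤ d + u) (sym (evenOffset-up d<t)) t≤

-- A cycle of length suc bs + suc (down + up), laid out on the odd slots of the columns
-- start, …, start + bs, then on the even slots of the columns low + down, low + down ∸ 1, …, low,
-- and finally on those of low + down + 1, …, low + down + up.
record Gadget : Set where
  constructor gadget
  field
    start bs low down up : ℕ
open Gadget

gadgetLength : Gadget → ℕ
gadgetLength g = suc (bs g) + suc (down g + up g)

nextStart nextLow : Gadget → ℕ
nextStart g = start g + suc (bs g)
nextLow   g = low g + suc (down g + up g)

gadgetSlot : Gadget → ℕ → Slot
gadgetSlot g j with j ≤? bs g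
... | yes _ = start g + j , true
... | no  _ = low g + evenOffset (down g) (j ∸ suc (bs g)) , false

gadgetSlot-odd : ∀ g {j} → j ≤ bs g → gadgetSlot g j ≡ (start g + j , true)
gadgetSlot-odd g {j} j≤bs with j ≤? bs g
... | yes _    = refl
... | no  j≰bs = ⊥-elim (j≰bs j≤bs)

gadgetSlot-even : ∀ g t → gadgetSlot g (suc (bs g) + t) ≡ (low g + evenOffset (down g) t , false)
gadgetSlot-even g t with suc (bs g) + t ≤? bs g
... | yes le = ⊥-elim (<⇒≱ (s≤s (m≤m+n (bs g) t)) le)
... | no  _  = cong (λ t → low g + evenOffset (down g) t , false) (m+n∸m≡n (suc (bs g)) t)

data GadgetIndex (g : Gadget) : ℕ → Set where
  odd-part  : ∀ {j} → j ≤ bs g → GadgetIndex g j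
  even-part : ∀ t → t ≤ down g + up g → GadgetIndex g (suc (bs g) + t)

gadgetIndex : ∀ g {j} → j < gadgetLength g → GadgetIndex g j
gadgetIndex g {j} j<L with j ≤? bs g
... | yes j≤bs = odd-part j≤bs
... | no  j≰bs = subst (GadgetIndex g) j≡ (even-part (j ∸ suc (bs g)) (s≤s⁻¹ (+-cancelˡ-< (suc (bs g)) _ _ t<)))
  where
  j≡ : suc (bs g) + (j ∸ suc (bs g)) ≡ j
  j≡ = m+[n∸m]≡n (≰⇒> j≰bs)
  t< : suc (bs g) + (j ∸ suc (bs g)) < gadgetLength g
  t< = subst (_< gadgetLength g) (sym j≡) j<L

-- Exactly what makes every step of the gadget a SlotStep: the entry from column start + bs into the
-- even slots, the jump from column low to low + down + 1 (when up > 0), and the return to column start.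
record Admissible (g : Gadget) : Set where
  field
    entry  : low g + down g ≡ suc (start g + bs g) ⊎ low g + down g ≡ suc (suc (start g + bs g))
    return : (up g ≡ 0 × odd (low g) ≡ odd (start g))
           ⊎ (0 < up g × odd (down g) ≡ false × odd (low g + (down g + up g)) ≡ odd (start g))

true≢false : true ≢ false
true≢false ()

gadgetSlot-entry : ∀ g → gadgetSlot g (suc (bs g)) ≡ (low g + down g , false)
gadgetSlot-entry g = trans (cong (gadgetSlot g) (sym (+-identityʳ (suc (bs g))))) (gadgetSlot-even g 0)

evenOffset-end-0 : ∀ d → evenOffset d (d + 0) ≡ 0
evenOffset-end-0 d = trans (evenOffset-down (≤-reflexive (+-identityʳ d))) (trans (cong (d ∸_) (+-identityʳ d)) (n∸n≡0 d))

gadgetSlot-injective : ∀ g {j j′} → j < gadgetLength g → j′ < gadgetLength g →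
                       gadgetSlot g j ≡ gadgetSlot g j′ → j ≡ j′
gadgetSlot-injective g j<L j′<L e with gadgetIndex g j<L | gadgetIndex g j′<L
... | odd-part j≤ | odd-part j′≤ =
  +-cancelˡ-≡ (start g) _ _ (cong proj₁ (trans (sym (gadgetSlot-odd g j≤)) (trans e (gadgetSlot-odd g j′≤))))
... | even-part t _ | even-part t′ _ = cong (suc (bs g) +_) (evenOffset-injective (down g)
  (+-cancelˡ-≡ (low g) _ _ (cong proj₁ (trans (sym (gadgetSlot-even g t)) (trans e (gadgetSlot-even g t′))))))
... | odd-part j≤ | even-part t′ _ =
  ⊥-elim (true≢false (cong proj₂ (trans (sym (gadgetSlot-odd g j≤)) (trans e (gadgetSlot-even g t′)))))
... | even-part t _ | odd-part j′≤ =
  ⊥-elim (true≢false (cong proj₂ (trans (sym (gadgetSlot-odd g j′≤)) (trans (sym e) (gadgetSlot-even g t)))))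

InColumns : ℕ → ℕ → ℕ → ℕ → Slot → Set
InColumns c a c′ a′ (i , true)  = c ≤ i × i < c′
InColumns c a c′ a′ (i , false) = a ≤ i × i < a′

gadgetSlot-inColumns : ∀ g {j} → j < gadgetLength g →
                       InColumns (start g) (low g) (nextStart g) (nextLow g) (gadgetSlot g j)
gadgetSlot-inColumns g j<L with gadgetIndex g j<L
... | odd-part {j} j≤ rewrite gadgetSlot-odd g j≤ = m≤m+n (start g) j , +-monoʳ-< (start g) (s≤s j≤)
... | even-part t t≤ rewrite gadgetSlot-even g t =
  m≤m+n (low g) _ , +-monoʳ-< (low g) (s≤s (evenOffset-≤ (down g) (up g) t≤))

module _ (g : Gadget) (admissible : Admissible g) where
  open Admissible admissible

  turn-parity : ∀ {t} → t < down g + up g → t ≡ down g → odd (down g) ≡ false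
  turn-parity t<d+u refl with return
  ... | inj₁ (u≡0 , _)        = ⊥-elim (<-irrefl (trans (sym (+-identityʳ _)) (cong (down g +_) (sym u≡0))) t<d+u)
  ... | inj₂ (_ , d-even , _) = d-even

  gadget-step : ∀ {j} → suc j < gadgetLength g → SlotStep (gadgetSlot g j) (gadgetSlot g (suc j))
  gadget-step {j} sj<L with gadgetIndex g (<-trans (n<1+n j) sj<L)
  ... | odd-part j≤bs with m≤n⇒m<n∨m≡n j≤bs
  ...   | inj₁ j<bs rewrite gadgetSlot-odd g j≤bs | gadgetSlot-odd g j<bs = inj₁ (+-suc (start g) j)
  ...   | inj₂ refl rewrite gadgetSlot-odd g j≤bs | gadgetSlot-entry g = entry
  gadget-step sj<L | even-part t _ =
    subst₂ SlotStep (sym (gadgetSlot-even g t)) (sym next)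
           (odd-+-≢ (low g) (evenOffset-step (down g) t (turn-parity t<d+u)))
    where
    next : gadgetSlot g (suc (suc (bs g) + t)) ≡ (low g + evenOffset (down g) (suc t) , false)
    next = trans (cong (gadgetSlot g) (sym (+-suc (suc (bs g)) t))) (gadgetSlot-even g (suc t))
    t<d+u : t < down g + up g
    t<d+u = s≤s⁻¹ (+-cancelˡ-< (suc (bs g)) _ _ (subst (_< gadgetLength g) (sym (+-suc (suc (bs g)) t)) sj<L))

  gadget-return : SlotStep (gadgetSlot g (suc (bs g) + (down g + up g))) (gadgetSlot g 0)
  gadget-return rewrite gadgetSlot-even g (down g + up g) | gadgetSlot-odd g (z≤n {bs g}) | +-identityʳ (start g)
    with return
  ... | inj₁ (u≡0 , low-parity) rewrite u≡0 | evenOffset-end-0 (down g) | +-identityʳ (low g) =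
    λ e → not-¬ low-parity (sym e)
  ... | inj₂ (0<u , _ , end-parity) rewrite evenOffset-up (m<m+n (down g) 0<u) = λ e → not-¬ end-parity (sym e)

  gadget-close : ∀ {j} → suc j ≡ gadgetLength g → SlotStep (gadgetSlot g j) (gadgetSlot g 0)
  gadget-close {j} j+1≡L = subst (λ i → SlotStep (gadgetSlot g i) (gadgetSlot g 0)) (sym j≡) gadget-return
    where
    j≡ : j ≡ suc (bs g) + (down g + up g)
    j≡ = suc-injective (trans j+1≡L (+-suc (suc (bs g)) (down g + up g)))

data Shape (L : ℕ) : Set where
  evenLength : ∀ b → L ≡ suc b + suc b → Shape L
  oddLength  : ∀ b → L ≡ suc (suc b + suc b) → Shape L

shape : ∀ {L} → 2 ≤ L → Shape L
shape {L} 2≤L = subst Shape (consBit-odd-⌊/2⌋ L) (split (odd L) ⌊ L /2⌋ (⌊n/2⌋-mono 2≤L))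
  where
  split : ∀ b h → 1 ≤ h → Shape (consBit b h)
  split false (suc b) _ = evenLength b refl
  split true  (suc b) _ = oddLength b refl

-- The subscripts are the offsets low ∸ start before and after the gadget (see admissible₂₁ and nextLow₂₁).
gadget₂₂ gadget₂₁ gadget₁₂ gadget₂₃ gadget₃₂ : ℕ → ℕ → ℕ → Gadget
gadget₂₂ c a b = gadget c b a b 0
gadget₂₁ c a b = gadget c (suc b) a b 0
gadget₁₂ c a b = gadget c b a b 1
gadget₂₃ c a b = gadget c (suc b) a b 2
gadget₃₂ c a b = gadget c (suc (suc b)) a b 1

admissible₂₂ : ∀ {c a b} → a ≡ c + 2 → Admissible (gadget₂₂ c a b)
admissible₂₂ {c} {_} {b} refl = record
  { entry  = inj₂ (arith c b)
  ; return = inj₁ (refl , odd-+-double c 1) }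
  where arith : ∀ c b → c + 2 + b ≡ suc (suc (c + b))
        arith = solve-∀

admissible₂₁ : ∀ {c a b} → a ≡ c + 2 → Admissible (gadget₂₁ c a b)
admissible₂₁ {c} {_} {b} refl = record
  { entry  = inj₁ (arith c b)
  ; return = inj₁ (refl , odd-+-double c 1) }
  where arith : ∀ c b → c + 2 + b ≡ suc (c + suc b)
        arith = solve-∀

admissible₁₂ : ∀ {c a b} → a ≡ c + 1 → odd b ≡ false → Admissible (gadget₁₂ c a b)
admissible₁₂ {c} {_} {b} refl b-even = record
  { entry  = inj₁ (arith₁ c b)
  ; return = inj₂ (s≤s z≤n , b-even , trans (cong odd (arith₂ c b)) (odd-+-even c (b + 2) b+2-even)) }
  where arith₁ : ∀ c b → c + 1 + b ≡ suc (c + b)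
        arith₁ = solve-∀
        arith₂ : ∀ c b → c + 1 + (b + 1) ≡ c + (b + 2)
        arith₂ = solve-∀
        b+2-even : odd (b + 2) ≡ false
        b+2-even = even-+2 b b-even

admissible₂₃ : ∀ {c a b} → a ≡ c + 2 → odd b ≡ false → Admissible (gadget₂₃ c a b)
admissible₂₃ {c} {_} {b} refl b-even = record
  { entry  = inj₁ (arith₁ c b)
  ; return = inj₂ (s≤s z≤n , b-even , trans (cong odd (arith₂ c b)) (odd-+-even c (b + 2 + 2) b+4-even)) }
  where arith₁ : ∀ c b → c + 2 + b ≡ suc (c + suc b)
        arith₁ = solve-∀
        arith₂ : ∀ c b → c + 2 + (b + 2) ≡ c + (b + 2 + 2)
        arith₂ = solve-∀
        b+4-even : odd (b + 2 + 2) ≡ false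
        b+4-even = even-+2 (b + 2) (even-+2 b b-even)

admissible₃₂ : ∀ {c a b} → a ≡ c + 3 → odd b ≡ false → Admissible (gadget₃₂ c a b)
admissible₃₂ {c} {_} {b} refl b-even = record
  { entry  = inj₁ (arith₁ c b)
  ; return = inj₂ (s≤s z≤n , b-even , trans (cong odd (arith₂ c b)) (odd-+-even c (b + 2 + 2) b+4-even)) }
  where arith₁ : ∀ c b → c + 3 + b ≡ suc (c + suc (suc b))
        arith₁ = solve-∀
        arith₂ : ∀ c b → c + 3 + (b + 1) ≡ c + (b + 2 + 2)
        arith₂ = solve-∀
        b+4-even : odd (b + 2 + 2) ≡ false
        b+4-even = even-+2 (b + 2) (even-+2 b b-even)

length₂₂ : ∀ c a b → gadgetLength (gadget₂₂ c a b) ≡ suc b + suc b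
length₂₂ c a b = cong (λ t → suc b + suc t) (+-identityʳ b)

length₂₁ : ∀ c a b → gadgetLength (gadget₂₁ c a b) ≡ suc (suc b + suc b)
length₂₁ c a b = cong (λ t → suc (suc b + suc t)) (+-identityʳ b)

length₁₂ : ∀ c a b → gadgetLength (gadget₁₂ c a b) ≡ suc (suc b + suc b)
length₁₂ c a b = arith b
  where arith : ∀ b → suc b + suc (b + 1) ≡ suc (suc b + suc b)
        arith = solve-∀

length₂₃ : ∀ c a b → gadgetLength (gadget₂₃ c a b) ≡ suc (suc (suc b) + suc (suc b))
length₂₃ c a b = arith b
  where arith : ∀ b → suc (suc b) + suc (b + 2) ≡ suc (suc (suc b) + suc (suc b))
        arith = solve-∀

length₃₂ : ∀ c a b → gadgetLength (gadget₃₂ c a b) ≡ suc (suc (suc b) + suc (suc b))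
length₃₂ c a b = arith b
  where arith : ∀ b → suc (suc (suc b)) + suc (b + 1) ≡ suc (suc (suc b) + suc (suc b))
        arith = solve-∀

nextLow₂₂ : ∀ {c a b} → a ≡ c + 2 → nextLow (gadget₂₂ c a b) ≡ nextStart (gadget₂₂ c a b) + 2
nextLow₂₂ {c} {_} {b} refl = arith c b
  where arith : ∀ c b → c + 2 + suc (b + 0) ≡ c + suc b + 2
        arith = solve-∀

nextLow₂₁ : ∀ {c a b} → a ≡ c + 2 → nextLow (gadget₂₁ c a b) ≡ nextStart (gadget₂₁ c a b) + 1
nextLow₂₁ {c} {_} {b} refl = arith c b
  where arith : ∀ c b → c + 2 + suc (b + 0) ≡ c + suc (suc b) + 1
        arith = solve-∀

nextLow₁₂ : ∀ {c a b} → a ≡ c + 1 → nextLow (gadget₁₂ c a b) ≡ nextStart (gadget₁₂ c a b) + 2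
nextLow₁₂ {c} {_} {b} refl = arith c b
  where arith : ∀ c b → c + 1 + suc (b + 1) ≡ c + suc b + 2
        arith = solve-∀

nextLow₂₃ : ∀ {c a b} → a ≡ c + 2 → nextLow (gadget₂₃ c a b) ≡ nextStart (gadget₂₃ c a b) + 3
nextLow₂₃ {c} {_} {b} refl = arith c b
  where arith : ∀ c b → c + 2 + suc (b + 2) ≡ c + suc (suc b) + 3
        arith = solve-∀

nextLow₃₂ : ∀ {c a b} → a ≡ c + 3 → nextLow (gadget₃₂ c a b) ≡ nextStart (gadget₃₂ c a b) + 2
nextLow₃₂ {c} {_} {b} refl = arith c b
  where arith : ∀ c b → c + 3 + suc (b + 1) ≡ c + suc (suc (suc b)) + 2
        arith = solve-∀

inColumns-weaken : ∀ {c a c′ a′ c₀ a₀ c₁ a₁} s → c₀ ≤ c → a₀ ≤ a → c′ ≤ c₁ → a′ ≤ a₁ →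
                   InColumns c a c′ a′ s → InColumns c₀ a₀ c₁ a₁ s
inColumns-weaken (_ , true)  c₀≤c _ c′≤c₁ _ (c≤i , i<c′) = ≤-trans c₀≤c c≤i , <-≤-trans i<c′ c′≤c₁
inColumns-weaken (_ , false) _ a₀≤a _ a′≤a₁ (a≤i , i<a′) = ≤-trans a₀≤a a≤i , <-≤-trans i<a′ a′≤a₁

inColumns-disjoint : ∀ {c a c′ a′ c″ a″} s s′ → InColumns c a c′ a′ s → InColumns c′ a′ c″ a″ s′ → s ≢ s′
inColumns-disjoint (_ , true)  (_ , true)  (_ , i<c′) (c′≤i′ , _) e = <⇒≢ (<-≤-trans i<c′ c′≤i′) (cong proj₁ e)
inColumns-disjoint (_ , false) (_ , false) (_ , i<a′) (a′≤i′ , _) e = <⇒≢ (<-≤-trans i<a′ a′≤i′) (cong proj₁ e)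
inColumns-disjoint (_ , true)  (_ , false) _ _ e = true≢false (cong proj₂ e)
inColumns-disjoint (_ , false) (_ , true)  _ _ e = true≢false (sym (cong proj₂ e))

start≤nextStart : ∀ g → start g ≤ nextStart g
start≤nextStart g = m≤m+n (start g) _

low≤nextLow : ∀ g → low g ≤ nextLow g
low≤nextLow g = m≤m+n (low g) _

data Chain {K : Set} : ℕ → ℕ → List (K × Gadget) → ℕ → ℕ → Set where
  []   : ∀ {c a} → Chain c a [] c a
  link : ∀ {k g es c′ a′} → Chain (nextStart g) (nextLow g) es c′ a′ → Chain (start g) (low g) ((k , g) ∷ es) c′ a′

chain-mono : ∀ {K : Set} {c a es c′ a′} → Chain {K} c a es c′ a′ → c ≤ c′ × a ≤ a′
chain-mono []                   = ≤-refl , ≤-refl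
chain-mono (link {g = g} chain) with chain-mono chain
... | c≤ , a≤ = ≤-trans (start≤nextStart g) c≤ , ≤-trans (low≤nextLow g) a≤

module Layout {K : Set} (_≟ᵏ_ : DecidableEquality K) (len : K → ℕ) (2≤len : ∀ k → 2 ≤ len k) where

  Entry : Set
  Entry = K × Gadget

  keys : List Entry → List K
  keys = map proj₁

  record Fits (e : Entry) : Set where
    field
      length≡    : len (proj₁ e) ≡ gadgetLength (proj₂ e)
      admissible : Admissible (proj₂ e)

  -- The default is never used: only keys of the list are looked up.
  gadgetOf : List Entry → K → Gadget
  gadgetOf []             k = gadget 0 0 0 0 0
  gadgetOf ((k₀ , g) ∷ es) k with k ≟ᵏ k₀
  ... | yes _ = g
  ... | no  _ = gadgetOf es k

  ∈-tail : ∀ {k k₀ : K} {ks} → k ∈ k₀ ∷ ks → k ≢ k₀ → k ∈ ks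
  ∈-tail (here k≡k₀) k≢k₀ = ⊥-elim (k≢k₀ k≡k₀)
  ∈-tail (there k∈)  _    = k∈

  gadgetOf-fits : ∀ {es k} → All Fits es → k ∈ keys es → Fits (k , gadgetOf es k)
  gadgetOf-fits {(k₀ , g) ∷ es} {k} (fits ∷ all-fit) k∈ with k ≟ᵏ k₀
  ... | yes refl = fits
  ... | no  k≢k₀ = gadgetOf-fits all-fit (∈-tail k∈ k≢k₀)

  fits-index : ∀ {k g j} → Fits (k , g) → j < len k → j < gadgetLength g
  fits-index {j = j} fits j<len = subst (j <_) (Fits.length≡ fits) j<len

  fits-step : ∀ {k g j} → Fits (k , g) → suc j < len k → SlotStep (gadgetSlot g j) (gadgetSlot g (suc j))
  fits-step {g = g} fits j+1<len = gadget-step g (Fits.admissible fits) (fits-index fits j+1<len)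

  fits-close : ∀ {k g j} → Fits (k , g) → suc j ≡ len k → SlotStep (gadgetSlot g j) (gadgetSlot g 0)
  fits-close {g = g} fits j+1≡len = gadget-close g (Fits.admissible fits) (trans j+1≡len (Fits.length≡ fits))

  chain-inColumns : ∀ {c a es c′ a′ k j} → Chain c a es c′ a′ → All Fits es → k ∈ keys es → j < len k →
                    InColumns c a c′ a′ (gadgetSlot (gadgetOf es k) j)
  chain-inColumns {k = k} {j} (link {k = k₀} {g} {es} chain) (fits ∷ all-fit) k∈ j<len with k ≟ᵏ k₀
  ... | yes refl = inColumns-weaken (gadgetSlot g j) ≤-refl ≤-refl (proj₁ (chain-mono chain)) (proj₂ (chain-mono chain))
                     (gadgetSlot-inColumns g (fits-index fits j<len))
  ... | no  k≢k₀ = inColumns-weaken (gadgetSlot (gadgetOf es k) j) (start≤nextStart g) (low≤nextLow g) ≤-refl ≤-refl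
                     (chain-inColumns chain all-fit (∈-tail k∈ k≢k₀) j<len)

  chain-injective : ∀ {c a es c′ a′ k k′ j j′} → Chain c a es c′ a′ → All Fits es → k ∈ keys es → k′ ∈ keys es →
                    j < len k → j′ < len k′ → gadgetSlot (gadgetOf es k) j ≡ gadgetSlot (gadgetOf es k′) j′ →
                    k ≡ k′ × j ≡ j′
  chain-injective {k = k} {k′} {j} {j′} (link {k = k₀} {g} {es} chain) (fits ∷ all-fit) k∈ k′∈ j<len j′<len e
    with k ≟ᵏ k₀ | k′ ≟ᵏ k₀
  ... | yes refl | yes refl = refl , gadgetSlot-injective g (fits-index fits j<len) (fits-index fits j′<len) e
  ... | yes refl | no  k′≢k₀ = ⊥-elim (inColumns-disjoint (gadgetSlot g j) (gadgetSlot (gadgetOf es k′) j′)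
          (gadgetSlot-inColumns g (fits-index fits j<len))
          (chain-inColumns chain all-fit (∈-tail k′∈ k′≢k₀) j′<len) e)
  ... | no  k≢k₀ | yes refl = ⊥-elim (inColumns-disjoint (gadgetSlot g j′) (gadgetSlot (gadgetOf es k) j)
          (gadgetSlot-inColumns g (fits-index fits j′<len))
          (chain-inColumns chain all-fit (∈-tail k∈ k≢k₀) j<len) (sym e))
  ... | no  k≢k₀ | no  k′≢k₀ = chain-injective chain all-fit (∈-tail k∈ k≢k₀) (∈-tail k′∈ k′≢k₀) j<len j′<len e

  chain-sum : ∀ {c a es c′ a′} → Chain c a es c′ a′ → All Fits es → c + a + sum (map len (keys es)) ≡ c′ + a′
  chain-sum {c} {a} []                             []                = +-identityʳ (c + a)
  chain-sum {c′ = c′} {a′} (link {k = k} {g} {es} chain) (fits ∷ all-fit) = begin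
    start g + low g + (len k + rest)           ≡⟨ cong (λ l → start g + low g + (l + rest)) (Fits.length≡ fits) ⟩
    start g + low g + (gadgetLength g + rest)  ≡⟨ regroup (start g) (low g) (bs g) (down g + up g) rest ⟩
    nextStart g + nextLow g + rest             ≡⟨ chain-sum chain all-fit ⟩
    c′ + a′                                    ∎
    where
    open ≡-Reasoning
    rest : ℕ
    rest = sum (map len (keys es))
    regroup : ∀ s l b t r → s + l + (suc b + suc t + r) ≡ s + suc b + (l + suc t) + r
    regroup = solve-∀

  fits : ∀ {k g L} → len k ≡ L → gadgetLength g ≡ L → Admissible g → Fits (k , g)
  fits len≡L length≡L admissible = record { length≡ = trans len≡L (sym length≡L) ; admissible = admissible }

  record OddCycle : Set where
    constructor oddCycle
    field
      key    : K
      half   : ℕ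
      key-length : len key ≡ suc (suc half + suc half)
  open OddCycle

  pending : Maybe OddCycle → List K
  pending nothing  = []
  pending (just o) = key o ∷ []

  -- Even cycles are placed as they come; odd cycles are placed in pairs, the first cycle of a
  -- pair waiting in the Maybe argument for the second.
  assign : ℕ → ℕ → Maybe OddCycle → List K → List Entry
  assign c a p (k ∷ ks) with shape (2≤len k) | p
  ... | evenLength b _        | p′     = (k , g) ∷ assign (nextStart g) (nextLow g) p′ ks
    where g : Gadget
          g = gadget₂₂ c a b
  ... | oddLength b k-length  | nothing = assign c a (just (oddCycle k b k-length)) ks
  ... | oddLength b _         | just o with odd b | odd (half o)
  ...   | false | _     = (key o , g₁) ∷ (k , g₂) ∷ assign (nextStart g₂) (nextLow g₂) nothing ks
    where g₁ g₂ : Gadget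
          g₁ = gadget₂₁ c a (half o)
          g₂ = gadget₁₂ (nextStart g₁) (nextLow g₁) b
  ...   | true  | false = (k , g₁) ∷ (key o , g₂) ∷ assign (nextStart g₂) (nextLow g₂) nothing ks
    where g₁ g₂ : Gadget
          g₁ = gadget₂₁ c a b
          g₂ = gadget₁₂ (nextStart g₁) (nextLow g₁) (half o)
  ...   | true  | true  = (key o , g₁) ∷ (k , g₂) ∷ assign (nextStart g₂) (nextLow g₂) nothing ks
    where g₁ g₂ : Gadget
          g₁ = gadget₂₃ c a (pred (half o))
          g₂ = gadget₃₂ (nextStart g₁) (nextLow g₁) (pred b)
  assign c a nothing  [] = []
  assign c a (just o) [] = (key o , gadget₂₁ c a (half o)) ∷ []

  assign-keys : ∀ c a p ks → keys (assign c a p ks) ↭ pending p ++ ks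
  assign-keys c a p (k ∷ ks) with shape (2≤len k) | p
  ... | evenLength b _ | p′      = ↭-trans (prep k (assign-keys _ _ p′ ks)) (↭-sym (shift k (pending p′) ks))
  ... | oddLength b _  | nothing = assign-keys c a _ ks
  ... | oddLength b _  | just o with odd b | odd (half o)
  ...   | false | _     = prep (key o) (prep k (assign-keys _ _ nothing ks))
  ...   | true  | false = swap k (key o) (assign-keys _ _ nothing ks)
  ...   | true  | true  = prep (key o) (prep k (assign-keys _ _ nothing ks))
  assign-keys c a nothing  [] = ↭-refl
  assign-keys c a (just o) [] = ↭-refl

  Ends : ℕ → ℕ → Set
  Ends c a = a ≡ c + 2 ⊎ a ≡ c + 1

  assign-chain : ∀ c a p ks → a ≡ c + 2 →
                 ∃₂ λ c′ a′ → Chain c a (assign c a p ks) c′ a′ × All Fits (assign c a p ks) × Ends c′ a′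
  assign-chain c a p (k ∷ ks) a≡ with shape (2≤len k) | p
  ... | evenLength b k-length | p′ with assign-chain _ _ p′ ks (nextLow₂₂ a≡)
  ...   | c′ , a′ , chain , all-fit , ends =
    c′ , a′ , link chain , fits k-length (length₂₂ c a b) (admissible₂₂ a≡) ∷ all-fit , ends
  assign-chain c a p (k ∷ ks) a≡ | oddLength b _ | nothing = assign-chain c a _ ks a≡
  assign-chain c a p (k ∷ ks) a≡ | oddLength b k-length | just o with odd b in b-parity | odd (half o) in h-parity
  ... | false | _ with assign-chain _ _ nothing ks (nextLow₁₂ (nextLow₂₁ a≡))
  ...   | c′ , a′ , chain , all-fit , ends =
    c′ , a′ , link (link chain) ,
    fits (key-length o) (length₂₁ c a (half o)) (admissible₂₁ a≡) ∷
    fits k-length (length₁₂ (nextStart g₁) (nextLow g₁) b) (admissible₁₂ (nextLow₂₁ a≡) b-parity) ∷ all-fit ,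
    ends
    where g₁ : Gadget
          g₁ = gadget₂₁ c a (half o)
  assign-chain c a p (k ∷ ks) a≡ | oddLength b k-length | just o | true | false
    with assign-chain _ _ nothing ks (nextLow₁₂ (nextLow₂₁ a≡))
  ... | c′ , a′ , chain , all-fit , ends =
    c′ , a′ , link (link chain) ,
    fits k-length (length₂₁ c a b) (admissible₂₁ a≡) ∷
    fits (key-length o) (length₁₂ (nextStart g₁) (nextLow g₁) (half o)) (admissible₁₂ (nextLow₂₁ a≡) h-parity) ∷
    all-fit , ends
    where g₁ : Gadget
          g₁ = gadget₂₁ c a b
  assign-chain c a p (k ∷ ks) a≡ | oddLength b k-length | just o | true | true
    with odd⇒pred-even h-parity | odd⇒pred-even b-parity
  ... | h≡ , h′-even | b≡ , b′-even with assign-chain _ _ nothing ks (nextLow₃₂ (nextLow₂₃ a≡))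
  ...   | c′ , a′ , chain , all-fit , ends =
    c′ , a′ , link (link chain) ,
    fits (trans (key-length o) (cong (λ h → suc (suc h + suc h)) h≡)) (length₂₃ c a (pred (half o)))
         (admissible₂₃ a≡ h′-even) ∷
    fits (trans k-length (cong (λ h → suc (suc h + suc h)) b≡)) (length₃₂ (nextStart g₁) (nextLow g₁) (pred b))
         (admissible₃₂ (nextLow₂₃ a≡) b′-even) ∷
    all-fit , ends
    where g₁ : Gadget
          g₁ = gadget₂₃ c a (pred (half o))
  assign-chain c a nothing  [] a≡ = c , a , [] , [] , inj₁ a≡
  assign-chain c a (just o) [] a≡ =
    _ , _ , link [] , fits (key-length o) (length₂₁ c a (half o)) (admissible₂₁ a≡) ∷ [] , inj₂ (nextLow₂₁ a≡)

-- Dimension at least 3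

∸-<-window : ∀ {M lo x} → M ≤ x → x < lo + M → x ∸ M < lo
∸-<-window {M} {lo} {x} M≤x x< = +-cancelʳ-< M (x ∸ M) lo (subst (_< lo + M) (sym (m∸n+n≡m M≤x)) x<)

%-window : ∀ {M lo x} .{{_ : NonZero M}} → lo ≤ M → M ≤ x → x < lo + M → x % M ≡ x ∸ M
%-window lo≤M M≤x x< = trans (sym (m≤n⇒[n∸m]%m≡n%m M≤x)) (m<n⇒m%n≡m (<-≤-trans (∸-<-window M≤x x<) lo≤M))

%-window-injective : ∀ {M lo a a′} .{{_ : NonZero M}} → lo ≤ M →
                     lo ≤ a → a < lo + M → lo ≤ a′ → a′ < lo + M → a % M ≡ a′ % M → a ≡ a′
%-window-injective {M} {lo} {a} {a′} lo≤M lo≤a a< lo≤a′ a′< e with <-≤-connex a M | <-≤-connex a′ M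
... | inj₁ a<M | inj₁ a′<M = trans (sym (m<n⇒m%n≡m a<M)) (trans e (m<n⇒m%n≡m a′<M))
... | inj₂ M≤a | inj₂ M≤a′ =
  ∸-cancelʳ-≡ M≤a M≤a′ (trans (sym (%-window lo≤M M≤a a<)) (trans e (%-window lo≤M M≤a′ a′<)))
... | inj₁ a<M | inj₂ M≤a′ = ⊥-elim (<⇒≱ (∸-<-window M≤a′ a′<)
  (subst (lo ≤_) (trans (sym (m<n⇒m%n≡m a<M)) (trans e (%-window lo≤M M≤a′ a′<))) lo≤a))
... | inj₂ M≤a | inj₁ a′<M = ⊥-elim (<⇒≱ (∸-<-window M≤a a<)
  (subst (lo ≤_) (trans (sym (m<n⇒m%n≡m a′<M)) (trans (sym e) (%-window lo≤M M≤a a<))) lo≤a′))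

consBit-% : ∀ b i M .{{_ : NonZero M}} .{{_ : NonZero (2 * M)}} → consBit b i % (2 * M) ≡ consBit b (i % M)
consBit-% b i M = begin
  consBit b i % (2 * M)
    ≡⟨ cong (λ x → consBit b x % (2 * M)) (m≡m%n+[m/n]*n i M) ⟩
  consBit b (r + q * M) % (2 * M)
    ≡⟨ cong (_% (2 * M)) (sym (consBit-+-double b r (q * M))) ⟩
  (consBit b r + (q * M + q * M)) % (2 * M)
    ≡⟨ cong (λ x → (consBit b r + x) % (2 * M)) (double-* q M) ⟩
  (consBit b r + q * (2 * M)) % (2 * M)
    ≡⟨ [m+kn]%n≡m%n (consBit b r) q (2 * M) ⟩
  consBit b r % (2 * M)
    ≡⟨ m<n⇒m%n≡m (subst (consBit b r <_) (double M) below) ⟩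
  consBit b r
    ∎
  where
  open ≡-Reasoning
  r q : ℕ
  r = i % M
  q = i / M
  double-* : ∀ q M → q * M + q * M ≡ q * (2 * M)
  double-* = solve-∀
  double : ∀ M → M + M ≡ 2 * M
  double = solve-∀
  below : consBit b r < M + M
  below = consBit-< b (m%n<n i M)

-- Modulo 2 * M the even slots of columns M and M + 1 wrap around to columns 0 and 1, which are
-- otherwise unused by even slots.
slotPosition-%-injective : ∀ {M} .{{_ : NonZero M}} .{{_ : NonZero (2 * M)}} → 2 ≤ M → ∀ {s s′} →
  InColumns 0 2 M (2 + M) s → InColumns 0 2 M (2 + M) s′ →
  slotPosition s % (2 * M) ≡ slotPosition s′ % (2 * M) → s ≡ s′
slotPosition-%-injective {M} 2≤M {i , b} {i′ , b′} in-s in-s′ e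
  with consBit-injective {b} {b′} {i % M} {i′ % M} (trans (sym (consBit-% b i M)) (trans e (consBit-% b′ i′ M)))
slotPosition-%-injective {M} 2≤M {i , true}  {i′ , true}  (0≤i , i<) (0≤i′ , i′<) e | _ , i≡ =
  cong (_, true) (%-window-injective z≤n 0≤i i< 0≤i′ i′< i≡)
slotPosition-%-injective {M} 2≤M {i , false} {i′ , false} (2≤i , i<) (2≤i′ , i′<) e | _ , i≡ =
  cong (_, false) (%-window-injective 2≤M 2≤i i< 2≤i′ i′< i≡)
slotPosition-%-injective {M} 2≤M {i , true}  {i′ , false} _ _ e | () , _
slotPosition-%-injective {M} 2≤M {i , false} {i′ , true}  _ _ e | () , _

⌊/2⌋-double-≤ : ∀ {c M} → c + c ≤ suc (M + M) → c ≤ M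
⌊/2⌋-double-≤ {c} {M} le = subst₂ _≤_ (sym (n≡⌊n+n/2⌋ c)) (⌊consBit/2⌋ true M) (⌊n/2⌋-mono le)

module Dimension≥3 (k : ℕ) (f : F (suc (suc (suc k)))) (f-injective : ∀ {x y} → f x ≡ f y → x ≡ y)
                   (no-fixed-point : ∀ x → f x ≢ x) where
  open Orbits f f-injective
  open Layout _≟ᶜ_ period (2≤period no-fixed-point)

  private
    n M : ℕ
    n = suc (suc (suc k))
    M = 2 ^ suc (suc k)

    instance
      M-nonZero : NonZero M
      M-nonZero = m^n≢0 2 (suc (suc k))
      2M-nonZero : NonZero (2 * M)
      2M-nonZero = m^n≢0 2 n

    2≤M : 2 ≤ M
    2≤M = ^-monoʳ-≤ 2 {1} {suc (suc k)} (s≤s z≤n)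

  entries : List Entry
  entries = assign 0 2 nothing reps

  private
    layout-chain : ∃₂ λ c′ a′ → Chain 0 2 entries c′ a′ × All Fits entries × Ends c′ a′
    layout-chain = assign-chain 0 2 nothing reps refl

    c′ a′ : ℕ
    c′ = proj₁ layout-chain
    a′ = proj₁ (proj₂ layout-chain)

    chain : Chain 0 2 entries c′ a′
    chain = proj₁ (proj₂ (proj₂ layout-chain))

    all-fit : All Fits entries
    all-fit = proj₁ (proj₂ (proj₂ (proj₂ layout-chain)))

    ends : Ends c′ a′
    ends = proj₂ (proj₂ (proj₂ (proj₂ layout-chain)))

  ∈-entries : ∀ {r} → IsRep r → r ∈ keys entries
  ∈-entries r-rep = ∈-resp-↭ (↭-sym (assign-keys 0 2 nothing reps)) (∈-reps r-rep)

  sum-lengths≤ : sum (map period (keys entries)) ≤ M + M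
  sum-lengths≤ = subst₂ _≤_ (sym (sum-↭ (map⁺ period (assign-keys 0 2 nothing reps)))) (2^suc (suc (suc k)))
                        (sum-periods≤2^n reps-unique reps-isRep)

  end-bounds : c′ ≤ M × a′ ≤ 2 + M
  end-bounds = c′≤M , ≤-trans a′≤c′+2 (subst (c′ + 2 ≤_) (+-comm M 2) (+-monoˡ-≤ 2 c′≤M))
    where
    c′+1≤a′ : c′ + 1 ≤ a′
    c′+1≤a′ = [ (λ e → subst (c′ + 1 ≤_) (sym e) (+-monoʳ-≤ c′ (s≤s z≤n))) , (λ e → ≤-reflexive (sym e)) ]′ ends
    a′≤c′+2 : a′ ≤ c′ + 2
    a′≤c′+2 = [ ≤-reflexive , (λ e → subst (_≤ c′ + 2) (sym e) (+-monoʳ-≤ c′ (s≤s z≤n))) ]′ ends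
    1+2c′≤ : 1 + (c′ + c′) ≤ 2 + sum (map period (keys entries))
    1+2c′≤ = subst₂ _≤_ (arith c′) (sym (chain-sum chain all-fit)) (+-monoʳ-≤ c′ c′+1≤a′)
      where arith : ∀ c → c + (c + 1) ≡ 1 + (c + c)
            arith = solve-∀
    c′≤M : c′ ≤ M
    c′≤M = ⌊/2⌋-double-≤ (+-cancelˡ-≤ 1 _ _ (≤-trans 1+2c′≤ (+-monoʳ-≤ 2 sum-lengths≤)))

  fits-of : ∀ {r} → IsRep r → Fits (r , gadgetOf entries r)
  fits-of r-rep = gadgetOf-fits all-fit (∈-entries r-rep)

  in-window : ∀ {r j} → IsRep r → j < period r → InColumns 0 2 M (2 + M) (gadgetSlot (gadgetOf entries r) j)
  in-window {r} {j} r-rep j<p = inColumns-weaken (gadgetSlot (gadgetOf entries r) j) ≤-refl ≤-refl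
    (proj₁ end-bounds) (proj₂ end-bounds) (chain-inColumns chain all-fit (∈-entries r-rep) j<p)

  layout : GrayCycleLayout f f-injective
  layout = record
    { position           = λ r j → slotPosition (gadgetSlot (gadgetOf entries r) j)
    ; position-step      = λ r r-rep j+1<p → slotStep-crosses k (fits-step (fits-of r-rep) j+1<p)
    ; position-close     = λ r r-rep j+1≡p → slotStep-crosses k (fits-close (fits-of r-rep) j+1≡p)
    ; position-injective = λ r-rep r′-rep j<p j′<p e →
        chain-injective chain all-fit (∈-entries r-rep) (∈-entries r′-rep) j<p j′<p
          (slotPosition-%-injective 2≤M (in-window r-rep j<p) (in-window r′-rep j′<p) (gray-≡⇒mod-≡ n e))
    }

Config0-unique : (x : Config 0) → x ≡ []
Config0-unique [] = refl

theorem5 : ∀ (n : ℕ) (f : F n) → Derangement f →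
    Σ (F n) λ h → (h ∼ f) × StronglyConnected h
theorem5 zero                f (_ , no-fixed-point) = ⊥-elim (no-fixed-point [] (Config0-unique (f [])))
theorem5 (suc zero)          f ((f-injective , _) , no-fixed-point) =
  conjugate-from-layout f f-injective (Dimension1.layout f f-injective no-fixed-point)
theorem5 (suc (suc zero))    f ((f-injective , _) , no-fixed-point) =
  conjugate-from-layout f f-injective (Dimension2.layout f f-injective no-fixed-point)
theorem5 (suc (suc (suc k))) f ((f-injective , _) , no-fixed-point) =
  conjugate-from-layout f f-injective (Dimension≥3.layout k f f-injective no-fixed-point)
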